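{- Let $d\ge3$, $\mathcal A$, $\varphi$, $\mathbf u$, $\mathcal T$ and $f$ be as in the context. Let $w$ be a bispecial factor associated with a triple $(a,w,b)\in\mathcal T$, such that $w$ has exactly two left and exactly two right extensions, and let $w'$ be the offspring of $w$ given by $f(a,w,b)$. If $r$ is a return word to $w$ in $\mathbf u$, then $s\varphi(r)s^{ -1}$ is a return word to $w'$, where $s$ is the longest common suffix of $\varphi(a)$ and $\varphi(d-1)$. In particular, if $\vec r$ is the Parikh vector of a return word to $w$, then $M\vec r$ is the Parikh vector of a return word to $w'$.
   Context: $\mathcal A=\{0,\dots,d-1\}$; $\varphi(i)=0(i+1)$ for $0\le i\le d-2$, $\varphi(d-1)=0(d-1)(d-1)$; $\mathbf u=u_0u_1\cdots$ is the fixed point of $\varphi$ starting with $0$, $\mathcal L(\mathbf u)$ its set of finite factors. $M$ is the incidence matrix, $M_{ij}=|\varphi(j)|_i$; Parikh vector of $v$ is $(|v|_0,\dots,|v|_{d-1})^T$. For a word $x$ with suffix $s$, $xs^{ -1}$ denotes $x$ with the suffix $s$ removed. If $j<\ell$ are consecutive occurrences of a factor $w$ in $\mathbf u$, then $u_j\cdots u_{\ell-1}$ is a return word to $w$. A factor $w$ is bispecial if it has at least two left extensions ($c$ with $cw\in\mathcal L(\mathbf u)$) and at least two right extensions. Let $\mathcal T=\{(a,w,b): w\text{ bispecial factor of }\mathbf u,\ a,b\in\mathcal A,\ a,b<d-1,\ aw,wb\in\mathcal L(\mathbf u)\}$; $w$ is the bispecial factor associated with $(a,w,b)$. For $(a,w,b)\in\mathcal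 T$ define $f(a,w,b)=(a',w',b')$ with $a'=(a+1)\bmod (d-1)$, $b'=(b+1)\bmod(d-1)$ (residues in $\{0,\dots,d-2\}$) and $w'=\varphi(w)0$ if $a<d-2,b<d-2$; $w'=\varphi(w)0(d-1)$ if $a<d-2,b=d-2$; $w'=(d-1)\varphi(w)0$ if $a=d-2,b<d-2$; $w'=(d-1)\varphi(w)0(d-1)$ if $a=b=d-2$; $w'$ is called the offspring of $w$. -}

module Defs where

open import Data.Nat using (ℕ; zero; suc; _+_; _*_; _∸_; _<_; _≤_; s≤s)
open import Data.Nat.Properties using (_<?_)
open import Data.Fin using (Fin; toℕ; fromℕ; fromℕ<) renaming (zero to fz)
open import Data.Fin.Properties using () renaming (_≟_ to _≟ᶠ_)
open import Data.List using (List; []; _∷_; _++_; [_]; length; reverse; concatMap; applyUpTo; filter; map; allFin)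
open import Data.Nat.ListAction using (sum)
open import Data.Product using (Σ; ∃; ∃-syntax; _×_; _,_)
open import Data.Sum using (_⊎_)
open import Relation.Nullary using (¬_; yes; no)
open import Relation.Binary.PropositionalEquality using (_≡_; _≢_)

-- Convention: the alphabet size is d = suc m (so the letter d-1 is `fromℕ m`).
-- Throughout, the hypothesis d ≥ 3 becomes m ≥ 2.

Letter : ℕ → Set
Letter m = Fin (suc m)

zeroL : ∀ {m} → Letter m
zeroL = fz

lastL : ∀ {m} → Letter m
lastL {m} = fromℕ m

φ : ∀ {m} → Letter m → List (Letter m)
φ {m} i with toℕ i <? m
... | yes p = zeroL ∷ fromℕ< {suc (toℕ i)} (s≤s p) ∷ []
... | no _  = zeroL ∷ lastL ∷ lastL ∷ []

φ* : ∀ {m} → List (Letter m) → List (Letter m)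
φ* = concatMap φ

φIter : ∀ {m} → ℕ → List (Letter m)
φIter zero    = zeroL ∷ []
φIter (suc k) = φ* (φIter k)

nth : ∀ {A : Set} → A → List A → ℕ → A
nth dflt []       _       = dflt
nth dflt (x ∷ xs) zero    = x
nth dflt (x ∷ xs) (suc n) = nth dflt xs n

-- the fixed point u of φ starting with 0: u_n is the n-th letter of φ^(n+1)(0)
-- (|φ^(n+1)(0)| ≥ n+1 and φ^k(0) is a prefix of φ^(k+1)(0), so the default is never used)
u : ∀ {m} → ℕ → Letter m
u {m} n = nth zeroL (φIter (suc n)) n

window : ∀ {m} → ℕ → ℕ → List (Letter m)
window i n = applyUpTo (λ k → u (i + k)) n

OccursAt : ∀ {m} → List (Letter m) → ℕ → Set
OccursAt w i = window i (length w) ≡ w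

IsFactor : ∀ {m} → List (Letter m) → Set
IsFactor w = ∃[ i ] OccursAt w i

IsReturnWord : ∀ {m} → List (Letter m) → List (Letter m) → Set
IsReturnWord {m} w r =
  Σ ℕ λ i → Σ ℕ λ j →
    i < j × OccursAt w i × OccursAt w j ×
    (∀ k → i < k → k < j → ¬ OccursAt w k) ×
    r ≡ window {m} i (j ∸ i)

LeftExt : ∀ {m} → List (Letter m) → Letter m → Set
LeftExt w c = IsFactor (c ∷ w)

RightExt : ∀ {m} → List (Letter m) → Letter m → Set
RightExt w c = IsFactor (w ++ [ c ])

IsBispecial : ∀ {m} → List (Letter m) → Set
IsBispecial {m} w =
  (Σ (Letter m) λ c₁ → Σ (Letter m) λ c₂ → c₁ ≢ c₂ × LeftExt w c₁ × LeftExt w c₂) ×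
  (Σ (Letter m) λ c₁ → Σ (Letter m) λ c₂ → c₁ ≢ c₂ × RightExt w c₁ × RightExt w c₂)

ExactlyTwoLeft : ∀ {m} → List (Letter m) → Set
ExactlyTwoLeft {m} w =
  Σ (Letter m) λ c₁ → Σ (Letter m) λ c₂ → c₁ ≢ c₂ × LeftExt w c₁ × LeftExt w c₂ ×
    (∀ c → LeftExt w c → c ≡ c₁ ⊎ c ≡ c₂)

ExactlyTwoRight : ∀ {m} → List (Letter m) → Set
ExactlyTwoRight {m} w =
  Σ (Letter m) λ c₁ → Σ (Letter m) λ c₂ → c₁ ≢ c₂ × RightExt w c₁ × RightExt w c₂ ×
    (∀ c → RightExt w c → c ≡ c₁ ⊎ c ≡ c₂)

-- (a, w, b) ∈ 𝓣   (a < d-1 means toℕ a < m)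
InT : ∀ {m} → Letter m → List (Letter m) → Letter m → Set
InT {m} a w b = IsBispecial w × toℕ a < m × toℕ b < m × LeftExt w a × RightExt w b

-- the offspring w' (middle component of f(a,w,b)); "a = d-2" means suc (toℕ a) = m
offspring : ∀ {m} → Letter m → List (Letter m) → Letter m → List (Letter m)
offspring {m} a w b = pre ++ φ* w ++ zeroL ∷ post
  where
  pre : List (Letter m)
  pre with suc (toℕ a) Data.Nat.≟ m
  ... | yes _ = lastL ∷ []
  ... | no _  = []
  post : List (Letter m)
  post with suc (toℕ b) Data.Nat.≟ m
  ... | yes _ = lastL ∷ []
  ... | no _  = []

lcp : ∀ {m} → List (Letter m) → List (Letter m) → List (Letter m)
lcp [] _ = []
lcp (_ ∷ _) [] = []
lcp (x ∷ xs) (y ∷ ys) with x ≟ᶠ y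
... | yes _ = x ∷ lcp xs ys
... | no _  = []

lcs : ∀ {m} → List (Letter m) → List (Letter m) → List (Letter m)
lcs x y = reverse (lcp (reverse x) (reverse y))

count : ∀ {m} → Letter m → List (Letter m) → ℕ
count c v = length (filter (c ≟ᶠ_) v)

Parikh : ∀ {m} → List (Letter m) → Letter m → ℕ
Parikh v c = count c v

M : ∀ {m} → Letter m → Letter m → ℕ
M i j = count i (φ j)

M·_ : ∀ {m} → (Letter m → ℕ) → Letter m → ℕ
(M·_ {m} r) i = sum (map (λ j → M i j * r j) (allFin (suc m)))

-- Cut u = φ(u) into the blocks φ(u_q), the block of u_q starting at position start q; the zeros
-- of u are exactly the block starts, and φ(c) 0 determines c. Hence an occurrence of w at i ≥ 1
-- gives an occurrence of w′ = pre φ(w) 0 post at start i − |pre|, and every occurrence of w′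
-- arises in this way. So consecutive occurrences of w map to consecutive occurrences of w′, and
-- the return word r becomes the conjugate y of pre φ(r), where pre = lcs(φ a, φ m) ∈ {ε, m}.
-- The letter m may be put in front when a = m − 1 because the only left extensions of w are then
-- a and m, both mapped to words with second letter m; that m extends every left (right) special
-- factor on the left (right) is shown by induction on the length through desubstitution.
-- Return words at position 0 are first moved by the recurrence of the prefixes of u.

module Submission where

open import Defs
open import Data.Nat.Properties
open import Algebra.Properties.CommutativeSemigroup +-commutativeSemigroup using (interchange)
open import Data.Nat using (ℕ; zero; suc; _+_; _*_; _∸_; _<_; _≤_; s≤s; z≤n; _≟_)
open import Data.Nat.ListAction using (sum)
open import Data.Fin using (Fin; toℕ; fromℕ<) renaming (zero to fz; suc to fs)
open import Data.Fin.Properties using (toℕ-fromℕ; toℕ-fromℕ<; toℕ-injective; toℕ≤pred[n]) renaming (_≟_ to _≟ᶠ_)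
open import Data.List using (List; []; _∷_; _++_; [_]; length; concatMap; take; drop; applyUpTo; filter; tabulate; initLast; _∷ʳ′_)
open import Data.List.Properties
  using (∷-injectiveˡ; ∷-injectiveʳ; ++-assoc; ++-cancelˡ; ++-identityʳ; concatMap-++; filter-++; map-tabulate;
         length-++; length-++-≤ˡ; length-drop; length-take; length-applyUpTo; take++drop≡id)
open import Data.List.Relation.Unary.All using (All; []; _∷_)
open import Data.Product using (Σ; ∃; _×_; _,_; proj₁; proj₂)
open import Data.Sum using (_⊎_; inj₁; inj₂)
open import Data.Empty using (⊥; ⊥-elim)
open import Data.Unit using (⊤; tt)
open import Function using (_∘_; id)
open import Relation.Nullary using (¬_; Dec; yes; no)
open import Relation.Binary.PropositionalEquality hiding ([_])

-- Parikh vectors of images under a substitution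

count-++ : ∀ {m} (c : Letter m) xs ys → count c (xs ++ ys) ≡ count c xs + count c ys
count-++ c xs ys = trans (cong length (filter-++ (c ≟ᶠ_) xs ys)) (length-++ (filter (c ≟ᶠ_) xs))

count-∷ : ∀ {m} (c x : Letter m) xs → count c (x ∷ xs) ≡ count c [ x ] + count c xs
count-∷ c x xs with c ≟ᶠ x
... | yes _ = refl
... | no _ = refl

count-suc : ∀ {m} (j x : Letter m) → count (fs j) [ fs x ] ≡ count j [ x ]
count-suc j x with j ≟ᶠ x
... | yes refl = refl
... | no _ = refl

sum-tabulate-+ : ∀ n (f g : Fin n → ℕ) →
  sum (tabulate (λ j → f j + g j)) ≡ sum (tabulate f) + sum (tabulate g)
sum-tabulate-+ zero f g = refl
sum-tabulate-+ (suc n) f g =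
  trans (cong (f fz + g fz +_) (sum-tabulate-+ n (λ j → f (fs j)) (λ j → g (fs j))))
        (interchange (f fz) (g fz) _ _)

sum-tabulate-0 : ∀ n (f : Fin n → ℕ) → (∀ j → f j ≡ 0) → sum (tabulate f) ≡ 0
sum-tabulate-0 zero f f≡0 = refl
sum-tabulate-0 (suc n) f f≡0 rewrite f≡0 fz = sum-tabulate-0 n (λ j → f (fs j)) (λ j → f≡0 (fs j))

tabulate-cong : ∀ {n} {f g : Fin n → ℕ} → (∀ j → f j ≡ g j) → tabulate f ≡ tabulate g
tabulate-cong {zero} f≗g = refl
tabulate-cong {suc n} f≗g = cong₂ _∷_ (f≗g fz) (tabulate-cong (λ j → f≗g (fs j)))

sum-tabulate-count-singleton : ∀ n (f : Letter n → ℕ) x →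
  sum (tabulate (λ j → f j * count j [ x ])) ≡ f x
sum-tabulate-count-singleton n f fz =
  trans (cong₂ _+_ (*-identityʳ (f fz)) (sum-tabulate-0 n _ (λ j → *-zeroʳ (f (fs j)))))
        (+-identityʳ (f fz))
sum-tabulate-count-singleton (suc n) f (fs x) =
  trans (cong₂ _+_ (*-zeroʳ (f fz)) (cong sum (tabulate-cong (λ j → cong (f (fs j) *_) (count-suc j x)))))
        (sum-tabulate-count-singleton n (λ j → f (fs j)) x)

count-concatMap : ∀ {n} (σ : Letter n → List (Letter n)) c r →
  count c (concatMap σ r) ≡ sum (tabulate (λ j → count c (σ j) * count j r))
count-concatMap {n} σ c [] = sym (sum-tabulate-0 (suc n) _ (λ j → *-zeroʳ (count c (σ j))))
count-concatMap {n} σ c (x ∷ r) = begin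
    count c (σ x ++ concatMap σ r)
  ≡⟨ count-++ c (σ x) (concatMap σ r) ⟩
    count c (σ x) + count c (concatMap σ r)
  ≡⟨ cong₂ _+_ (sym (sum-tabulate-count-singleton n (λ j → count c (σ j)) x)) (count-concatMap σ c r) ⟩
    sum (tabulate (λ j → count c (σ j) * count j [ x ])) + sum (tabulate (λ j → count c (σ j) * count j r))
  ≡⟨ sym (sum-tabulate-+ (suc n) (λ j → count c (σ j) * count j [ x ]) (λ j → count c (σ j) * count j r)) ⟩
    sum (tabulate (λ j → count c (σ j) * count j [ x ] + count c (σ j) * count j r))
  ≡⟨ cong sum (tabulate-cong (λ j → trans (sym (*-distribˡ-+ (count c (σ j)) (count j [ x ]) (count j r)))
                                          (cong (count c (σ j) *_) (sym (count-∷ j x r))))) ⟩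
    sum (tabulate (λ j → count c (σ j) * count j (x ∷ r)))
  ∎
  where open ≡-Reasoning

count-φ* : ∀ {m} c (r : List (Letter m)) → count c (φ* r) ≡ (M· Parikh r) c
count-φ* c r = trans (count-concatMap φ c r) (cong sum (sym (map-tabulate id (λ j → M c j * Parikh r j))))

conjugate-Parikh : ∀ {m} (s r y : List (Letter m)) → s ++ φ* r ≡ y ++ s → ∀ c → Parikh y c ≡ (M· Parikh r) c
conjugate-Parikh s r y eq c = trans count-y≡ (count-φ* c r)
  where
    open ≡-Reasoning
    count-y≡ : count c y ≡ count c (φ* r)
    count-y≡ = +-cancelʳ-≡ (count c s) _ _ (begin
      count c y + count c s       ≡⟨ sym (count-++ c y s) ⟩
      count c (y ++ s)            ≡⟨ cong (count c) (sym eq) ⟩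
      count c (s ++ φ* r)         ≡⟨ trans (count-++ c s (φ* r)) (+-comm (count c s) _) ⟩
      count c (φ* r) + count c s  ∎)

-- Occurrences of words in an infinite sequence

nth-++ˡ : ∀ {A : Set} (d : A) xs ys n → n < length xs → nth d (xs ++ ys) n ≡ nth d xs n
nth-++ˡ d (x ∷ xs) ys zero _ = refl
nth-++ˡ d (x ∷ xs) ys (suc n) (s≤s n<) = nth-++ˡ d xs ys n n<

nth-++ʳ : ∀ {A : Set} (d : A) xs ys n → nth d (xs ++ ys) (length xs + n) ≡ nth d ys n
nth-++ʳ d [] ys n = refl
nth-++ʳ d (x ∷ xs) ys n = nth-++ʳ d xs ys n

take-suc-nth : ∀ {A : Set} (d : A) xs n → n < length xs → take (suc n) xs ≡ take n xs ++ [ nth d xs n ]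
take-suc-nth d (x ∷ xs) zero _ = refl
take-suc-nth d (x ∷ xs) (suc n) (s≤s n<) = cong (x ∷_) (take-suc-nth d xs n n<)

module Occurrences {A : Set} (s : ℕ → A) where

  infix 4 _at_

  _at_ : List A → ℕ → Set
  [] at i = ⊤
  (c ∷ w) at i = s i ≡ c × w at suc i

  Factor : List A → Set
  Factor w = ∃ (w at_)

  segment : ℕ → ℕ → List A
  segment i n = applyUpTo (λ k → s (i + k)) n

  at-nth : ∀ (d : A) w i j → w at i → j < length w → s (i + j) ≡ nth d w j
  at-nth d (c ∷ w) i zero (sᵢ≡c , _) _ = trans (cong s (+-identityʳ i)) sᵢ≡c
  at-nth d (c ∷ w) i (suc j) (_ , w-at) (s≤s j<) = trans (cong s (+-suc i j)) (at-nth d w (suc i) j w-at j<)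

  nth-at : ∀ (d : A) w i → (∀ j → j < length w → s (i + j) ≡ nth d w j) → w at i
  nth-at d [] i _ = tt
  nth-at d (c ∷ w) i h =
    trans (cong s (sym (+-identityʳ i))) (h 0 (s≤s z≤n)) ,
    nth-at d w (suc i) (λ j j< → trans (cong s (sym (+-suc i j))) (h (suc j) (s≤s j<)))

  at-++⁻ : ∀ xs ys i → (xs ++ ys) at i → xs at i × ys at (i + length xs)
  at-++⁻ [] ys i ys-at = tt , subst (ys at_) (sym (+-identityʳ i)) ys-at
  at-++⁻ (x ∷ xs) ys i (sᵢ≡x , rest-at) with at-++⁻ xs ys (suc i) rest-at
  ... | xs-at , ys-at = (sᵢ≡x , xs-at) , subst (ys at_) (sym (+-suc i (length xs))) ys-at

  at-++⁺ : ∀ xs ys i → xs at i → ys at (i + length xs) → (xs ++ ys) at i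
  at-++⁺ [] ys i _ ys-at = subst (ys at_) (+-identityʳ i) ys-at
  at-++⁺ (x ∷ xs) ys i (sᵢ≡x , xs-at) ys-at =
    sᵢ≡x , at-++⁺ xs ys (suc i) xs-at (subst (ys at_) (+-suc i (length xs)) ys-at)

  at-unique : ∀ xs ys i → xs at i → ys at i → length xs ≡ length ys → xs ≡ ys
  at-unique [] [] i _ _ _ = refl
  at-unique (x ∷ xs) (y ∷ ys) i (sᵢ≡x , xs-at) (sᵢ≡y , ys-at) eq =
    cong₂ _∷_ (trans (sym sᵢ≡x) sᵢ≡y) (at-unique xs ys (suc i) xs-at ys-at (suc-injective eq))

  at-take : ∀ n xs i → xs at i → take n xs at i
  at-take zero xs i _ = tt
  at-take (suc n) [] i _ = tt
  at-take (suc n) (x ∷ xs) i (sᵢ≡x , xs-at) = sᵢ≡x , at-take n xs (suc i) xs-at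

  at-drop : ∀ n xs i → xs at i → drop n xs at (i + n)
  at-drop zero xs i xs-at = subst (xs at_) (sym (+-identityʳ i)) xs-at
  at-drop (suc n) [] i _ = tt
  at-drop (suc n) (x ∷ xs) i (_ , xs-at) = subst (drop n xs at_) (sym (+-suc i n)) (at-drop n xs (suc i) xs-at)

  at-prefix-++ : ∀ xs ys i → xs at i → ys at i → length xs ≤ length ys → ys ≡ xs ++ drop (length xs) ys
  at-prefix-++ xs ys i xs-at ys-at |xs|≤ = trans (sym (take++drop≡id (length xs) ys)) (cong (_++ drop (length xs) ys) (sym xs≡))
    where
      xs≡ : xs ≡ take (length xs) ys
      xs≡ = at-unique xs (take (length xs) ys) i xs-at (at-take (length xs) ys i ys-at)
              (sym (trans (length-take (length xs) ys) (m≤n⇒m⊓n≡m |xs|≤)))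

  at-prefix : ∀ xs ys i j → xs at i → ys at i → length xs ≤ length ys → ys at j → xs at j
  at-prefix xs ys i j xs-ati ys-ati |xs|≤ ys-atj =
    proj₁ (at-++⁻ xs _ j (subst (_at j) (at-prefix-++ xs ys i xs-ati ys-ati |xs|≤) ys-atj))

  at-infix : ∀ xs ys i o j → xs at (i + o) → ys at i → o + length xs ≤ length ys → ys at j → xs at (j + o)
  at-infix xs ys i o j xs-at ys-ati bound ys-atj =
    at-prefix xs (drop o ys) (i + o) (j + o) xs-at (at-drop o ys i ys-ati) |xs|≤ (at-drop o ys j ys-atj)
    where
      |xs|≤ : length xs ≤ length (drop o ys)
      |xs|≤ = subst (length xs ≤_) (sym (length-drop o ys))
                (subst (_≤ length ys ∸ o) (m+n∸m≡n o (length xs)) (∸-monoˡ-≤ o bound))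

  applyUpTo-at : ∀ n (f : ℕ → A) i → (∀ k → f k ≡ s (i + k)) → applyUpTo f n at i
  applyUpTo-at zero f i _ = tt
  applyUpTo-at (suc n) f i f≗ =
    trans (cong s (sym (+-identityʳ i))) (sym (f≗ 0)) ,
    applyUpTo-at n (λ k → f (suc k)) (suc i) (λ k → trans (f≗ (suc k)) (cong s (+-suc i k)))

  segment-at : ∀ i n → segment i n at i
  segment-at i n = applyUpTo-at n (λ k → s (i + k)) i (λ _ → refl)

  length-segment : ∀ i n → length (segment i n) ≡ n
  length-segment i n = length-applyUpTo _ n

  segment-suc : ∀ i n → segment i (suc n) ≡ s i ∷ segment (suc i) n
  segment-suc i n = at-unique _ _ i (segment-at i (suc n)) (refl , segment-at (suc i) n)
                      (trans (length-segment i (suc n)) (cong suc (sym (length-segment (suc i) n))))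

  segment-++ : ∀ i a b → segment i (a + b) ≡ segment i a ++ segment (i + a) b
  segment-++ i a b = at-unique _ _ i (segment-at i (a + b))
    (at-++⁺ (segment i a) _ i (segment-at i a)
      (subst (segment (i + a) b at_) (cong (i +_) (sym (length-segment i a))) (segment-at (i + a) b)))
    (trans (length-segment i (a + b))
      (sym (trans (length-++ (segment i a)) (cong₂ _+_ (length-segment i a) (length-segment (i + a) b)))))

  at⇒segment : ∀ w i → w at i → segment i (length w) ≡ w
  at⇒segment w i w-at = at-unique _ w i (segment-at i (length w)) w-at (length-segment i (length w))

  segment⇒at : ∀ w i → segment i (length w) ≡ w → w at i
  segment⇒at w i eq = subst (_at i) eq (segment-at i (length w))

All-nth : ∀ {A : Set} {P : A → Set} (d : A) xs n → All P xs → n < length xs → P (nth d xs n)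
All-nth d (x ∷ xs) zero (px ∷ _) _ = px
All-nth d (x ∷ xs) (suc n) (_ ∷ pxs) (s≤s n<) = All-nth d xs n pxs n<

module _ {A : Set} {c₁ c₂ : A} where

  ∈-pair-cover : ∀ {a b z : A} → a ≢ b → a ≡ c₁ ⊎ a ≡ c₂ → b ≡ c₁ ⊎ b ≡ c₂ → z ≡ c₁ ⊎ z ≡ c₂ → z ≡ a ⊎ z ≡ b
  ∈-pair-cover _ (inj₁ refl) _ (inj₁ refl) = inj₁ refl
  ∈-pair-cover _ (inj₂ refl) _ (inj₂ refl) = inj₁ refl
  ∈-pair-cover a≢b (inj₁ refl) (inj₁ refl) (inj₂ refl) = ⊥-elim (a≢b refl)
  ∈-pair-cover _ (inj₁ refl) (inj₂ refl) (inj₂ refl) = inj₂ refl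
  ∈-pair-cover _ (inj₂ refl) (inj₁ refl) (inj₁ refl) = inj₂ refl
  ∈-pair-cover a≢b (inj₂ refl) (inj₂ refl) (inj₁ refl) = ⊥-elim (a≢b refl)

  ∈-pair-three : ∀ {a b c : A} → a ≢ b → a ≢ c → b ≢ c →
    a ≡ c₁ ⊎ a ≡ c₂ → b ≡ c₁ ⊎ b ≡ c₂ → c ≡ c₁ ⊎ c ≡ c₂ → ⊥
  ∈-pair-three a≢b _ _ (inj₁ refl) (inj₁ refl) _ = a≢b refl
  ∈-pair-three a≢b _ _ (inj₂ refl) (inj₂ refl) _ = a≢b refl
  ∈-pair-three _ a≢c _ (inj₁ refl) (inj₂ refl) (inj₁ refl) = a≢c refl
  ∈-pair-three _ _ b≢c (inj₁ refl) (inj₂ refl) (inj₂ refl) = b≢c refl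
  ∈-pair-three _ _ b≢c (inj₂ refl) (inj₁ refl) (inj₁ refl) = b≢c refl
  ∈-pair-three _ a≢c _ (inj₂ refl) (inj₁ refl) (inj₂ refl) = a≢c refl

-- The substitution φ on the alphabet {0, …, m}

module FixedPoint (m : ℕ) (2≤m : 2 ≤ m) where

  Z L : Letter m
  Z = zeroL
  L = lastL

  toℕ-L : toℕ L ≡ m
  toℕ-L = toℕ-fromℕ m

  Z≢L : Z ≢ L
  Z≢L Z≡L with subst (2 ≤_) (sym (trans (cong toℕ Z≡L) toℕ-L)) 2≤m
  ... | ()

  <m⇒≢L : ∀ {c : Letter m} → toℕ c < m → c ≢ L
  <m⇒≢L c<m c≡L = <-irrefl (trans (cong toℕ c≡L) toℕ-L) c<m

  next : (c : Letter m) → toℕ c < m → Letter m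
  next c c<m = fromℕ< (s≤s c<m)

  toℕ-next : (c : Letter m) (c<m : toℕ c < m) → toℕ (next c c<m) ≡ suc (toℕ c)
  toℕ-next c c<m = toℕ-fromℕ< (s≤s c<m)

  φ-cases : (c : Letter m) →
    (Σ (toℕ c < m) λ c<m → φ c ≡ Z ∷ next c c<m ∷ []) ⊎ (c ≡ L × φ c ≡ Z ∷ L ∷ L ∷ [])
  φ-cases c with toℕ c <? m
  ... | yes c<m = inj₁ (c<m , refl)
  ... | no c≮m = inj₂ (toℕ-injective (trans (≤-antisym (toℕ≤pred[n] c) (≮⇒≥ c≮m)) (sym toℕ-L)) , refl)

  φ-L : φ L ≡ Z ∷ L ∷ L ∷ []
  φ-L with φ-cases L
  ... | inj₁ (L<m , _) = ⊥-elim (<m⇒≢L L<m refl)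
  ... | inj₂ (_ , eq) = eq

  ZeroFree : List (Letter m) → Set
  ZeroFree = All (_≢ Z)

  φ-shape : ∀ c → Σ (List (Letter m)) λ t → φ c ≡ Z ∷ t × ZeroFree t
  φ-shape c with φ-cases c
  ... | inj₁ (c<m , eq) = _ , eq , (λ next≡Z → 0≢1+n (sym (trans (sym (toℕ-next c c<m)) (cong toℕ next≡Z)))) ∷ []
  ... | inj₂ (_ , eq) = _ , eq , (Z≢L ∘ sym) ∷ (Z≢L ∘ sym) ∷ []

  2≤length-φ : ∀ c → 2 ≤ length (φ c)
  2≤length-φ c with φ-cases c
  ... | inj₁ (_ , eq) rewrite eq = s≤s (s≤s z≤n)
  ... | inj₂ (_ , eq) rewrite eq = s≤s (s≤s z≤n)

  length-φ≤3 : ∀ c → length (φ c) ≤ 3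
  length-φ≤3 c with φ-cases c
  ... | inj₁ (_ , eq) rewrite eq = s≤s (s≤s z≤n)
  ... | inj₂ (_ , eq) rewrite eq = ≤-refl

  length-φ-≢L : ∀ c → c ≢ L → length (φ c) ≡ 2
  length-φ-≢L c c≢L with φ-cases c
  ... | inj₁ (_ , eq) rewrite eq = refl
  ... | inj₂ (c≡L , _) = ⊥-elim (c≢L c≡L)

  -- third c is the letter after second c in φ c 0: m if c = m, and the 0 opening the next block otherwise.
  second third : Letter m → Letter m
  second c = nth Z (φ c) 1
  third c = nth Z (φ c ++ [ Z ]) 2

  second-third-injective : ∀ a b → second a ≡ second b → third a ≡ third b → a ≡ b
  second-third-injective a b 2nd≡ 3rd≡ with φ-cases a | φ-cases b
  ... | inj₁ (a<m , ea) | inj₁ (b<m , eb) rewrite ea | eb =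
    toℕ-injective (suc-injective (trans (sym (toℕ-next a a<m)) (trans (cong toℕ 2nd≡) (toℕ-next b b<m))))
  ... | inj₁ (_ , ea) | inj₂ (_ , eb) rewrite ea | eb = ⊥-elim (Z≢L 3rd≡)
  ... | inj₂ (_ , ea) | inj₁ (_ , eb) rewrite ea | eb = ⊥-elim (Z≢L (sym 3rd≡))
  ... | inj₂ (a≡L , _) | inj₂ (b≡L , _) = trans a≡L (sym b≡L)

  nth-1-φ : ∀ c xs → nth Z (φ c ++ xs) 1 ≡ second c
  nth-1-φ c xs with φ-cases c
  ... | inj₁ (_ , eq) rewrite eq = refl
  ... | inj₂ (_ , eq) rewrite eq = refl

  nth-2-φ : ∀ c xs → nth Z (φ c ++ Z ∷ xs) 2 ≡ third c
  nth-2-φ c xs with φ-cases c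
  ... | inj₁ (_ , eq) rewrite eq = refl
  ... | inj₂ (_ , eq) rewrite eq = refl

  second-L : second L ≡ L
  second-L = cong (λ w → nth Z w 1) φ-L

  toℕ-second : ∀ c → toℕ c < m → toℕ (second c) ≡ suc (toℕ c)
  toℕ-second c c<m with φ-cases c
  ... | inj₁ (c<m′ , eq) rewrite eq = toℕ-next c c<m′
  ... | inj₂ (c≡L , _) = ⊥-elim (<m⇒≢L c<m c≡L)

  -- u = φ(u), block by block

  U : ℕ → Letter m
  U = u {m}

  Φ : List (Letter m) → List (Letter m)
  Φ = φ* {m}

  open Occurrences U public

  Φ-++ : ∀ xs ys → Φ (xs ++ ys) ≡ Φ xs ++ Φ ys
  Φ-++ = concatMap-++ φ

  double≤length-Φ : ∀ xs → length xs + length xs ≤ length (Φ xs)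
  double≤length-Φ [] = z≤n
  double≤length-Φ (x ∷ xs) rewrite length-++ (φ x) {Φ xs} =
    ≤-trans (≤-reflexive (cong suc (+-suc (length xs) (length xs))))
            (+-mono-≤ (2≤length-φ x) (double≤length-Φ xs))

  φIter-suc : ∀ k → Σ (List (Letter m)) λ t → φIter (suc k) ≡ φIter k ++ t
  φIter-suc zero with φ-shape Z
  ... | t , eq , _ = t ++ [] , cong (_++ []) eq
  φIter-suc (suc k) with φIter-suc k
  ... | t , eq = Φ t , trans (cong Φ eq) (Φ-++ (φIter k) t)

  φIter-prefix : ∀ j k → Σ (List (Letter m)) λ t → φIter (j + k) ≡ φIter k ++ t
  φIter-prefix zero k = [] , sym (++-identityʳ (φIter k))
  φIter-prefix (suc j) k with φIter-prefix j k | φIter-suc (j + k)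
  ... | t , eq | t′ , eq′ = t ++ t′ , trans eq′ (trans (cong (_++ t′) eq) (++-assoc (φIter k) t t′))

  suc≤length-φIter : ∀ k → suc k ≤ length (φIter {m} k)
  suc≤length-φIter zero = s≤s z≤n
  suc≤length-φIter (suc k) =
    ≤-trans (s≤s (≤-trans (m≤m+n (suc k) k) (≤-reflexive (sym (+-suc k k)))))
            (≤-trans (+-mono-≤ (suc≤length-φIter k) (suc≤length-φIter k)) (double≤length-Φ (φIter k)))

  nth-φIter-stable : ∀ k k′ n → k ≤ k′ → n < length (φIter {m} k) → nth Z (φIter k′) n ≡ nth Z (φIter k) n
  nth-φIter-stable k k′ n k≤k′ n< with φIter-prefix (k′ ∸ k) k
  ... | t , eq rewrite m∸n+n≡m k≤k′ = trans (cong (λ w → nth Z w n) eq) (nth-++ˡ Z (φIter k) t n n<)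

  u-φIter : ∀ k n → n < length (φIter {m} k) → U n ≡ nth Z (φIter k) n
  u-φIter k n n< with ≤-total k (suc n)
  ... | inj₁ k≤ = nth-φIter-stable k (suc n) n k≤ n<
  ... | inj₂ ≥k = sym (nth-φIter-stable (suc n) k n ≥k (<⇒≤ (suc≤length-φIter (suc n))))

  -- start q = |φ(u₀ ⋯ u_{q-1})| is the position in u = φ(u) where the block φ(u_q) begins.
  start : ℕ → ℕ
  start zero = 0
  start (suc q) = start q + length (φ (U q))

  start≡length-Φ-take : ∀ k n → n ≤ length (φIter {m} k) → start n ≡ length (Φ (take n (φIter k)))
  start≡length-Φ-take k zero _ = refl
  start≡length-Φ-take k (suc n) n< = begin
      start n + length (φ (U n))
    ≡⟨ cong₂ _+_ (start≡length-Φ-take k n (<⇒≤ n<))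
                 (trans (cong (length ∘ φ) (u-φIter k n n<)) (cong length (sym (++-identityʳ (φ (nth Z xs n)))))) ⟩
      length (Φ (take n xs)) + length (Φ [ nth Z xs n ])
    ≡⟨ sym (trans (cong length (Φ-++ (take n xs) _)) (length-++ (Φ (take n xs)))) ⟩
      length (Φ (take n xs ++ [ nth Z xs n ]))
    ≡⟨ cong (length ∘ Φ) (sym (take-suc-nth Z xs n n<)) ⟩
      length (Φ (take (suc n) xs))
    ∎
    where
      open ≡-Reasoning
      xs = φIter k

  start+<length-Φ : ∀ q j → j < length (φ (U q)) → start q + j < length (Φ (φIter (suc q)))
  start+<length-Φ q j j< = begin-strict
      start q + j
    <⟨ +-monoʳ-< (start q) j< ⟩
      start (suc q)
    ≡⟨ start≡length-Φ-take (suc q) (suc q) (≤-trans (n≤1+n (suc q)) (suc≤length-φIter (suc q))) ⟩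
      length (Φ (take (suc q) xs))
    ≤⟨ m≤m+n _ _ ⟩
      length (Φ (take (suc q) xs)) + length (Φ (drop (suc q) xs))
    ≡⟨ sym (trans (cong length (Φ-++ (take (suc q) xs) _)) (length-++ (Φ (take (suc q) xs)))) ⟩
      length (Φ (take (suc q) xs ++ drop (suc q) xs))
    ≡⟨ cong (length ∘ Φ) (take++drop≡id (suc q) xs) ⟩
      length (Φ xs)
    ∎
    where
      open ≤-Reasoning hiding (start)
      xs = φIter (suc q)

  nth-Φ : ∀ xs n j → n < length xs → j < length (φ (nth Z xs n)) →
    nth Z (Φ xs) (length (Φ (take n xs)) + j) ≡ nth Z (φ (nth Z xs n)) j
  nth-Φ (x ∷ xs) zero j _ j< = nth-++ˡ Z (φ x) (Φ xs) j j<
  nth-Φ (x ∷ xs) (suc n) j (s≤s n<) j< =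
    trans (cong (nth Z (φ x ++ Φ xs)) (trans (cong (_+ j) (length-++ (φ x))) (+-assoc (length (φ x)) _ j)))
          (trans (nth-++ʳ Z (φ x) (Φ xs) _) (nth-Φ xs n j n< j<))

  u-block : ∀ q j → j < length (φ (U q)) → U (start q + j) ≡ nth Z (φ (U q)) j
  u-block q j j< = begin
      U (start q + j)
    ≡⟨ u-φIter (suc (suc q)) (start q + j) (start+<length-Φ q j j<) ⟩
      nth Z (Φ xs) (start q + j)
    ≡⟨ cong (λ p → nth Z (Φ xs) (p + j)) (start≡length-Φ-take (suc q) q (<⇒≤ q<)) ⟩
      nth Z (Φ xs) (length (Φ (take q xs)) + j)
    ≡⟨ nth-Φ xs q j q< (subst (λ c → j < length (φ c)) uq≡ j<) ⟩
      nth Z (φ (nth Z xs q)) j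
    ≡⟨ cong (λ c → nth Z (φ c) j) (sym uq≡) ⟩
      nth Z (φ (U q)) j
    ∎
    where
      open ≡-Reasoning
      xs = φIter (suc q)
      q< : q < length xs
      q< = ≤-trans (n≤1+n (suc q)) (suc≤length-φIter (suc q))
      uq≡ : U q ≡ nth Z xs q
      uq≡ = u-φIter (suc q) q q<

  φ-block-at : ∀ q → φ (U q) at start q
  φ-block-at q = nth-at Z (φ (U q)) (start q) (u-block q)

  u-start : ∀ q → U (start q) ≡ Z
  u-start q with φ-shape (U q) | u-block q 0 (<⇒≤ (2≤length-φ (U q)))
  ... | t , eq , _ | u≡ = trans (cong U (sym (+-identityʳ (start q)))) (trans u≡ (cong (λ w → nth Z w 0) eq))

  u-start+1 : ∀ q → U (start q + 1) ≡ second (U q)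
  u-start+1 q = u-block q 1 (2≤length-φ (U q))

  u-start+2 : ∀ q → U q ≡ L → U (start q + 2) ≡ L
  u-start+2 q uq≡L = trans (u-block q 2 (subst (λ c → 2 < length (φ c)) (sym uq≡L) (≤-reflexive (sym (cong length φ-L)))))
                          (trans (cong (λ c → nth Z (φ c) 2) uq≡L) (cong (λ w → nth Z w 2) φ-L))

  u-inside-block≢Z : ∀ q o → 0 < o → o < length (φ (U q)) → U (start q + o) ≢ Z
  u-inside-block≢Z q (suc o) _ o< with φ-shape (U q) | u-block q (suc o) o<
  ... | t , eq , t-free | u≡ rewrite eq = subst (_≢ Z) (sym u≡) (All-nth Z t o t-free (≤-pred o<))

  Φ-at : ∀ v q → v at q → Φ v at start q
  Φ-at [] q _ = tt
  Φ-at (c ∷ v) q (uq≡c , v-at) =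
    at-++⁺ (φ c) (Φ v) (start q) (subst (λ a → φ a at start q) uq≡c (φ-block-at q))
      (subst (Φ v at_) (cong (λ a → start q + length (φ a)) uq≡c) (Φ-at v (suc q) v-at))

  start+length-Φ : ∀ v q → v at q → start q + length (Φ v) ≡ start (q + length v)
  start+length-Φ [] q _ = trans (+-identityʳ (start q)) (cong start (sym (+-identityʳ q)))
  start+length-Φ (c ∷ v) q (uq≡c , v-at) = begin
      start q + length (φ c ++ Φ v)
    ≡⟨ trans (cong (start q +_) (length-++ (φ c))) (sym (+-assoc (start q) _ _)) ⟩
      start q + length (φ c) + length (Φ v)
    ≡⟨ cong (λ a → start q + length (φ a) + length (Φ v)) (sym uq≡c) ⟩
      start (suc q) + length (Φ v)
    ≡⟨ start+length-Φ v (suc q) v-at ⟩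
      start (suc q + length v)
    ≡⟨ cong start (sym (+-suc q (length v))) ⟩
      start (q + length (c ∷ v))
    ∎
    where open ≡-Reasoning

  Φ-Z-at : ∀ v q → v at q → (Φ v ++ [ Z ]) at start q
  Φ-Z-at v q v-at = at-++⁺ (Φ v) [ Z ] (start q) (Φ-at v q v-at)
    (subst ([ Z ] at_) (sym (start+length-Φ v q v-at)) (u-start (q + length v) , tt))

  start<start-suc : ∀ q → start q < start (suc q)
  start<start-suc q = m<m+n (start q) (≤-trans (s≤s z≤n) (2≤length-φ (U q)))

  start-mono-< : ∀ {q q′} → q < q′ → start q < start q′
  start-mono-< {q} {suc q′} (s≤s q≤q′) with m≤n⇒m<n∨m≡n q≤q′
  ... | inj₁ q<q′ = <-trans (start-mono-< q<q′) (start<start-suc q′)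
  ... | inj₂ refl = start<start-suc q

  start-cancel-< : ∀ {q q′} → start q < start q′ → q < q′
  start-cancel-< {q} {q′} st< with q <? q′
  ... | yes q<q′ = q<q′
  ... | no q≮q′ with m≤n⇒m<n∨m≡n (≮⇒≥ q≮q′)
  ...   | inj₁ q′<q = ⊥-elim (<-asym st< (start-mono-< q′<q))
  ...   | inj₂ refl = ⊥-elim (<-irrefl refl st<)

  double≤start : ∀ q → q + q ≤ start q
  double≤start zero = z≤n
  double≤start (suc q) = begin
      suc q + suc q
    ≡⟨ trans (cong suc (+-suc q q)) (+-comm 2 (q + q)) ⟩
      q + q + 2
    ≤⟨ +-mono-≤ (double≤start q) (2≤length-φ (U q)) ⟩
      start (suc q)
    ∎
    where open ≤-Reasoning hiding (start)

  record InBlock (j : ℕ) : Set where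
    constructor inBlock
    field
      index offset : ℕ
      j≡ : j ≡ start index + offset
      offset< : offset < length (φ (U index))

  blockOf : ∀ j → InBlock j
  blockOf zero = inBlock 0 0 refl (<⇒≤ (2≤length-φ (U 0)))
  blockOf (suc j) with blockOf j
  ... | inBlock q o j≡ o< with suc o <? length (φ (U q))
  ...   | yes so< = inBlock q (suc o) (trans (cong suc j≡) (sym (+-suc (start q) o))) so<
  ...   | no so≮ = inBlock (suc q) 0 sj≡ (<⇒≤ (2≤length-φ (U (suc q))))
    where
      sj≡ : suc j ≡ start (suc q) + 0
      sj≡ = trans (cong suc j≡) (trans (sym (+-suc (start q) o))
              (trans (cong (start q +_) (≤-antisym o< (≮⇒≥ so≮))) (sym (+-identityʳ _))))

  data PositionView : ℕ → Set where
    first-of : ∀ q → PositionView (start q)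
    second-of : ∀ q → PositionView (start q + 1)
    third-of : ∀ q → U q ≡ L → PositionView (start q + 2)

  positionView : ∀ j → PositionView j
  positionView j with blockOf j
  ... | inBlock q zero refl _ rewrite +-identityʳ (start q) = first-of q
  ... | inBlock q 1 refl _ = second-of q
  ... | inBlock q 2 refl o< with U q ≟ᶠ L
  ...   | yes uq≡L = third-of q uq≡L
  ...   | no uq≢L = ⊥-elim (<-irrefl (sym (length-φ-≢L (U q) uq≢L)) o<)
  positionView j | inBlock q (suc (suc (suc o))) _ o< = ⊥-elim (<⇒≱ o< (≤-trans (length-φ≤3 (U q)) (s≤s (s≤s (s≤s z≤n)))))

  second≢Z : ∀ c → second c ≢ Z
  second≢Z c with φ-shape c
  ... | t , eq , t-free rewrite eq = All-nth Z t 0 t-free (≤-trans (s≤s z≤n) (≤-pred (subst (λ w → 2 ≤ length w) eq (2≤length-φ c))))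

  start-suc-≢L : ∀ q → U q ≢ L → start (suc q) ≡ start q + 2
  start-suc-≢L q uq≢L = cong (start q +_) (length-φ-≢L (U q) uq≢L)

  start-suc-L : ∀ q → U q ≡ L → start (suc q) ≡ start q + 3
  start-suc-L q uq≡L = cong (start q +_) (trans (cong (length ∘ φ) uq≡L) (cong length φ-L))

  u≡Z⇒start : ∀ j → U j ≡ Z → Σ ℕ λ q → j ≡ start q
  u≡Z⇒start j uj≡Z with positionView j
  ... | first-of q = q , refl
  ... | second-of q = ⊥-elim (second≢Z (U q) (trans (sym (u-start+1 q)) uj≡Z))
  ... | third-of q uq≡L = ⊥-elim (Z≢L (trans (sym uj≡Z) (u-start+2 q uq≡L)))

  u-before-start : ∀ p q → suc p ≡ start (suc q) → U p ≡ second (U q)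
  u-before-start p q sp≡ with U q ≟ᶠ L
  ... | no uq≢L = trans (cong U (suc-injective (trans sp≡ (trans (start-suc-≢L q uq≢L) (+-suc (start q) 1))))) (u-start+1 q)
  ... | yes uq≡L = trans (cong U (suc-injective (trans sp≡ (trans (start-suc-L q uq≡L) (+-suc (start q) 2)))))
                         (trans (u-start+2 q uq≡L) (sym (trans (cong second uq≡L) second-L)))

  private
    pred-of-middle′ : ∀ j → PositionView j → ∀ p → j ≡ suc p → U j ≢ Z → U j ≢ L → U p ≡ Z
    pred-of-middle′ _ (first-of q) p _ uj≢Z _ = ⊥-elim (uj≢Z (u-start q))
    pred-of-middle′ _ (second-of q) p j≡ _ _ = trans (cong U (suc-injective (trans (sym j≡) (+-comm (start q) 1)))) (u-start q)
    pred-of-middle′ _ (third-of q uq≡L) p _ _ uj≢L = ⊥-elim (uj≢L (u-start+2 q uq≡L))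

    pred-of-L′ : ∀ j → PositionView j → ∀ p → j ≡ suc p → U j ≡ L → U p ≡ Z ⊎ U p ≡ L
    pred-of-L′ _ (first-of q) p _ uj≡L = ⊥-elim (Z≢L (trans (sym (u-start q)) uj≡L))
    pred-of-L′ _ (second-of q) p j≡ _ = inj₁ (trans (cong U (suc-injective (trans (sym j≡) (+-comm (start q) 1)))) (u-start q))
    pred-of-L′ _ (third-of q uq≡L) p j≡ _ =
      inj₂ (trans (cong U (suc-injective (trans (sym j≡) (+-suc (start q) 1))))
                  (trans (u-start+1 q) (trans (cong second uq≡L) second-L)))

  pred-of-middle : ∀ p → U (suc p) ≢ Z → U (suc p) ≢ L → U p ≡ Z
  pred-of-middle p = pred-of-middle′ (suc p) (positionView (suc p)) p refl

  pred-of-L : ∀ p → U (suc p) ≡ L → U p ≡ Z ⊎ U p ≡ L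
  pred-of-L p = pred-of-L′ (suc p) (positionView (suc p)) p refl

  succ-of-middle : ∀ p → U p ≢ Z → U p ≢ L → U (suc p) ≡ Z
  succ-of-middle p up≢Z up≢L with positionView p
  ... | first-of q = ⊥-elim (up≢Z (u-start q))
  ... | third-of q uq≡L = ⊥-elim (up≢L (u-start+2 q uq≡L))
  ... | second-of q with U q ≟ᶠ L
  ...   | yes uq≡L = ⊥-elim (up≢L (trans (u-start+1 q) (trans (cong second uq≡L) second-L)))
  ...   | no uq≢L = trans (cong U (trans (sym (+-suc (start q) 1)) (sym (start-suc-≢L q uq≢L)))) (u-start (suc q))

  succ-of-L : ∀ p → U p ≡ L → U (suc p) ≡ Z ⊎ U (suc p) ≡ L
  succ-of-L p up≡L with positionView p
  ... | first-of q = ⊥-elim (Z≢L (trans (sym (u-start q)) up≡L))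
  ... | third-of q uq≡L =
    inj₁ (trans (cong U (trans (sym (+-suc (start q) 2)) (sym (start-suc-L q uq≡L)))) (u-start (suc q)))
  ... | second-of q with U q ≟ᶠ L
  ...   | yes uq≡L = inj₂ (trans (cong U (sym (+-suc (start q) 1))) (u-start+2 q uq≡L))
  ...   | no uq≢L = inj₁ (trans (cong U (trans (sym (+-suc (start q) 1)) (sym (start-suc-≢L q uq≢L)))) (u-start (suc q)))

  φ-Z-at : ∀ q → (φ (U q) ++ [ Z ]) at start q
  φ-Z-at q = at-++⁺ (φ (U q)) [ Z ] (start q) (φ-block-at q) (u-start (suc q) , tt)

  letter-occurs : ∀ k → k ≤ m → Σ ℕ λ p → toℕ (U p) ≡ k
  letter-occurs zero _ = 0 , cong toℕ (u-start 0)
  letter-occurs (suc k) k<m with letter-occurs k (<⇒≤ k<m)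
  ... | p , up≡k = start p + 1 ,
    trans (cong toℕ (u-start+1 p)) (trans (toℕ-second (U p) (subst (_< m) (sym up≡k) k<m)) (cong suc up≡k))

  L-occurs : Σ ℕ λ p → U p ≡ L
  L-occurs with letter-occurs m ≤-refl
  ... | p , up≡m = p , toℕ-injective (trans up≡m (sym toℕ-L))

  ZLLZ-at : Σ ℕ λ p → (Z ∷ L ∷ L ∷ Z ∷ []) at p
  ZLLZ-at with L-occurs
  ... | p , up≡L = start p , subst (λ w → (w ++ [ Z ]) at start p) (trans (cong φ up≡L) φ-L) (φ-Z-at p)

  ZL-factor : Factor (Z ∷ L ∷ [])
  ZL-factor with ZLLZ-at
  ... | p , (z , l , _) = p , z , l , tt

  LL-factor : Factor (L ∷ L ∷ [])
  LL-factor with ZLLZ-at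
  ... | p , (_ , l , l′ , _) = suc p , l , l′ , tt

  LZ-factor : Factor (L ∷ Z ∷ [])
  LZ-factor with ZLLZ-at
  ... | p , (_ , _ , l , z , _) = suc (suc p) , l , z , tt

  -- Desubstitution

  Φ-Z-head : ∀ v xs → Σ (List (Letter m)) λ ys → Φ v ++ Z ∷ xs ≡ Z ∷ ys
  Φ-Z-head [] xs = xs , refl
  Φ-Z-head (c ∷ v) xs with φ-shape c
  ... | t , eq , _ = t ++ Φ v ++ Z ∷ xs , trans (++-assoc (φ c) (Φ v) (Z ∷ xs)) (cong (_++ Φ v ++ Z ∷ xs) eq)

  φ-Z-cancel : ∀ a b xs ys → φ a ++ Z ∷ xs ≡ φ b ++ Z ∷ ys → a ≡ b
  φ-Z-cancel a b xs ys eq = second-third-injective a b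
    (trans (sym (nth-1-φ a (Z ∷ xs))) (trans (cong (λ w → nth Z w 1) eq) (nth-1-φ b (Z ∷ ys))))
    (trans (sym (nth-2-φ a xs)) (trans (cong (λ w → nth Z w 2) eq) (nth-2-φ b ys)))

  φ-Z-at⇒second-third : ∀ c xs p → (φ c ++ Z ∷ xs) at p → U (p + 1) ≡ second c × U (p + 2) ≡ third c
  φ-Z-at⇒second-third c xs p w-at =
    trans (at-nth Z _ p 1 w-at (≤-trans (2≤length-φ c) (length-++-≤ˡ (φ c)))) (nth-1-φ c (Z ∷ xs)) ,
    trans (at-nth Z _ p 2 w-at (≤-trans (+-mono-≤ (2≤length-φ c) (s≤s (z≤n {length xs}))) (≤-reflexive (sym (length-++ (φ c))))))
          (nth-2-φ c xs)

  Φ-Z-at⁻¹ : ∀ v q → (Φ v ++ [ Z ]) at start q → v at q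
  Φ-Z-at⁻¹ [] q _ = tt
  Φ-Z-at⁻¹ (c ∷ v) q image-at = uq≡c , Φ-Z-at⁻¹ v (suc q) rest-at
    where
      image-at′ : (φ c ++ Φ v ++ [ Z ]) at start q
      image-at′ = subst (_at start q) (++-assoc (φ c) (Φ v) [ Z ]) image-at
      ys = proj₁ (Φ-Z-head v [])
      c-at = φ-Z-at⇒second-third c ys (start q) (subst (λ w → (φ c ++ w) at start q) (proj₂ (Φ-Z-head v [])) image-at′)
      uq-at = φ-Z-at⇒second-third (U q) [] (start q) (φ-Z-at q)
      uq≡c : U q ≡ c
      uq≡c = second-third-injective (U q) c (trans (sym (proj₁ uq-at)) (proj₁ c-at)) (trans (sym (proj₂ uq-at)) (proj₂ c-at))
      rest-at : (Φ v ++ [ Z ]) at start (suc q)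
      rest-at = subst ((Φ v ++ [ Z ]) at_) (cong (λ a → start q + length (φ a)) (sym uq≡c))
                  (proj₂ (at-++⁻ (φ c) _ (start q) image-at′))

  ZeroFree-∌Z : ∀ xs ys → ¬ ZeroFree (xs ++ Z ∷ ys)
  ZeroFree-∌Z [] ys (Z≢Z ∷ _) = Z≢Z refl
  ZeroFree-∌Z (x ∷ xs) ys (_ ∷ free) = ZeroFree-∌Z xs ys free

  -- A word Φ v 0 r with r free of 0 determines v: the zeros mark the block boundaries.
  Φ-Z-injectiveˡ : ∀ v₁ v₂ r₁ r₂ → ZeroFree r₁ → ZeroFree r₂ → Φ v₁ ++ Z ∷ r₁ ≡ Φ v₂ ++ Z ∷ r₂ → v₁ ≡ v₂
  Φ-Z-injectiveˡ [] [] _ _ _ _ _ = refl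
  Φ-Z-injectiveˡ [] (b ∷ v₂) r₁ r₂ r₁-free _ eq with φ-shape b
  ... | t , φb≡ , _ = ⊥-elim (ZeroFree-∌Z (t ++ Φ v₂) r₂ (subst ZeroFree r₁≡ r₁-free))
    where
      r₁≡ : r₁ ≡ (t ++ Φ v₂) ++ Z ∷ r₂
      r₁≡ = trans (∷-injectiveʳ (trans eq (trans (++-assoc (φ b) (Φ v₂) (Z ∷ r₂)) (cong (_++ Φ v₂ ++ Z ∷ r₂) φb≡))))
                  (sym (++-assoc t (Φ v₂) (Z ∷ r₂)))
  Φ-Z-injectiveˡ (a ∷ v₁) [] r₁ r₂ r₁-free r₂-free eq = sym (Φ-Z-injectiveˡ [] (a ∷ v₁) r₂ r₁ r₂-free r₁-free (sym eq))
  Φ-Z-injectiveˡ (a ∷ v₁) (b ∷ v₂) r₁ r₂ r₁-free r₂-free eq = cong₂ _∷_ a≡b (Φ-Z-injectiveˡ v₁ v₂ r₁ r₂ r₁-free r₂-free rest≡)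
    where
      eq′ : φ a ++ (Φ v₁ ++ Z ∷ r₁) ≡ φ b ++ (Φ v₂ ++ Z ∷ r₂)
      eq′ = trans (sym (++-assoc (φ a) (Φ v₁) (Z ∷ r₁))) (trans eq (++-assoc (φ b) (Φ v₂) (Z ∷ r₂)))
      a≡b : a ≡ b
      a≡b = φ-Z-cancel a b _ _ (trans (cong (φ a ++_) (sym (proj₂ (Φ-Z-head v₁ r₁))))
                                 (trans eq′ (cong (φ b ++_) (proj₂ (Φ-Z-head v₂ r₂)))))
      rest≡ : Φ v₁ ++ Z ∷ r₁ ≡ Φ v₂ ++ Z ∷ r₂
      rest≡ = ++-cancelˡ (φ a) _ _ (trans eq′ (cong (λ c → φ c ++ Φ v₂ ++ Z ∷ r₂) (sym a≡b)))

  Φ-Z-injectiveʳ : ∀ t₁ t₂ v₁ v₂ → ZeroFree t₁ → ZeroFree t₂ → t₁ ++ Φ v₁ ++ [ Z ] ≡ t₂ ++ Φ v₂ ++ [ Z ] → v₁ ≡ v₂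
  Φ-Z-injectiveʳ [] [] v₁ v₂ _ _ eq = Φ-Z-injectiveˡ v₁ v₂ [] [] [] [] eq
  Φ-Z-injectiveʳ [] (b ∷ t₂) v₁ v₂ _ (b≢Z ∷ _) eq =
    ⊥-elim (b≢Z (sym (∷-injectiveˡ (trans (sym (proj₂ (Φ-Z-head v₁ []))) eq))))
  Φ-Z-injectiveʳ (a ∷ t₁) [] v₁ v₂ (a≢Z ∷ _) _ eq =
    ⊥-elim (a≢Z (sym (∷-injectiveˡ (trans (sym (proj₂ (Φ-Z-head v₂ []))) (sym eq)))))
  Φ-Z-injectiveʳ (a ∷ t₁) (b ∷ t₂) v₁ v₂ (_ ∷ t₁-free) (_ ∷ t₂-free) eq =
    Φ-Z-injectiveʳ t₁ t₂ v₁ v₂ t₁-free t₂-free (∷-injectiveʳ eq)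

  segment-inside-block-ZeroFree : ∀ q k n → 0 < k → k + n ≤ length (φ (U q)) → ZeroFree (segment (start q + k) n)
  segment-inside-block-ZeroFree q k zero _ _ = []
  segment-inside-block-ZeroFree q k (suc n) 0<k bound rewrite segment-suc (start q + k) n =
    u-inside-block≢Z q k 0<k (≤-trans (s≤s (m≤m+n k n)) (≤-trans (≤-reflexive (sym (+-suc k n))) bound)) ∷
    subst (λ i → ZeroFree (segment i n)) (+-suc (start q) k)
      (segment-inside-block-ZeroFree q (suc k) n (≤-trans 0<k (n≤1+n k)) (≤-trans (≤-reflexive (sym (+-suc k n))) bound))

  -- Left special factors have the left extension m

  -- x w c, with w beginning with 0, as a factor of φ(x′ v c′) 0.
  record LeftPreimage (x : Letter m) (w : List (Letter m)) (c : Letter m) : Set where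
    field
      x′ c′ : Letter m
      v ρ rest : List (Letter m)
      x≡second : x ≡ second x′
      preimage-factor : Factor (x′ ∷ v ++ [ c′ ])
      w≡ : w ≡ Φ v ++ Z ∷ ρ
      ρ-free : ZeroFree ρ
      image≡ : Φ (v ++ [ c′ ]) ++ [ Z ] ≡ (w ++ [ c ]) ++ rest
      shorter : length v < length w

  lift-left : ∀ {x w c} (pre : LeftPreimage x w c) →
    let open LeftPreimage pre in Factor (L ∷ v ++ [ c′ ]) → Factor (L ∷ w ++ [ c ])
  lift-left {w = w} {c} pre (t , Lvc-at) = drop-ZL (subst (_at start t) lifted≡ (Φ-Z-at (L ∷ v ++ [ c′ ]) t Lvc-at))
    where
      open LeftPreimage pre
      lifted≡ : Φ (L ∷ v ++ [ c′ ]) ++ [ Z ] ≡ Z ∷ L ∷ ((L ∷ w ++ [ c ]) ++ rest)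
      lifted≡ = trans (++-assoc (φ L) (Φ (v ++ [ c′ ])) [ Z ]) (cong₂ _++_ φ-L image≡)
      drop-ZL : (Z ∷ L ∷ ((L ∷ w ++ [ c ]) ++ rest)) at start t → Factor (L ∷ w ++ [ c ])
      drop-ZL (_ , _ , Lwc-at) = _ , proj₁ (at-++⁻ (L ∷ w ++ [ c ]) rest _ Lwc-at)

  start≤⇒≤ : ∀ {q r} j → start q ≤ j → j < start (suc r) → q ≤ r
  start≤⇒≤ j st≤ j< = ≤-pred (start-cancel-< (≤-<-trans st≤ j<))

  q+length-segment : ∀ {q r} → q ≤ r → q + length (segment q (r ∸ q)) ≡ r
  q+length-segment {q} {r} q≤r = trans (cong (q +_) (length-segment q (r ∸ q))) (m+[n∸m]≡n q≤r)

  start+length-Φ-segment : ∀ {q r} → q ≤ r → start q + length (Φ (segment q (r ∸ q))) ≡ start r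
  start+length-Φ-segment {q} {r} q≤r =
    trans (start+length-Φ (segment q (r ∸ q)) q (segment-at q (r ∸ q))) (cong start (q+length-segment q≤r))

  segment-∷ʳ-at : ∀ {q r} → q ≤ r → (segment q (r ∸ q) ++ [ U r ]) at q
  segment-∷ʳ-at {q} {r} q≤r =
    at-++⁺ _ [ U r ] q (segment-at q (r ∸ q)) (subst ([ U r ] at_) (sym (q+length-segment q≤r)) (refl , tt))

  length-Φ-∷ʳ : ∀ v c → length (Φ (v ++ [ c ])) ≡ length (Φ v) + length (φ c)
  length-Φ-∷ʳ v c = trans (cong length (Φ-++ v [ c ]))
    (trans (length-++ (Φ v)) (cong (λ k → length (Φ v) + length k) (++-identityʳ (φ c))))

  Φ-segment-Z-at : ∀ {q r} o → q ≤ r → o < length (φ (U r)) →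
    (Φ (segment q (r ∸ q)) ++ Z ∷ segment (start r + 1) o) at start q
  Φ-segment-Z-at {q} {r} o q≤r o< =
    at-++⁺ (Φ (segment q (r ∸ q))) _ (start q) (Φ-at (segment q (r ∸ q)) q (segment-at q (r ∸ q)))
      (subst ((Z ∷ segment (start r + 1) o) at_) (sym (start+length-Φ-segment q≤r))
        (u-start r , subst (segment (start r + 1) o at_) (+-comm (start r) 1) (segment-at _ o)))

  leftPreimage : ∀ x w′ c p → (x ∷ (Z ∷ w′) ++ [ c ]) at p → LeftPreimage x (Z ∷ w′) c
  leftPreimage x w′ c p (up≡x , wc-at) with u≡Z⇒start (suc p) (proj₁ wc-at)
  ... | suc q′ , sp≡ = record
    { x′ = U q′ ; c′ = U r ; v = v ; ρ = ρ ; rest = drop (length (w ++ [ c ])) image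
    ; x≡second = trans (sym up≡x) (u-before-start p q′ sp≡)
    ; preimage-factor = q′ , refl , segment-∷ʳ-at q≤r
    ; w≡ = at-unique w _ (start q) w-at (Φ-segment-Z-at o q≤r o<)
             (trans (cong suc |w′|≡) (trans (sym (+-suc (length (Φ v)) o))
               (sym (trans (length-++ (Φ v)) (cong (λ k → length (Φ v) + suc k) (length-segment (start r + 1) o))))))
    ; ρ-free = segment-inside-block-ZeroFree r 1 o (s≤s z≤n) o<
    ; image≡ = at-prefix-++ (w ++ [ c ]) image (start q) wc-at′ (Φ-Z-at _ q (segment-∷ʳ-at q≤r)) |wc|≤|image|
    ; shorter = s≤s (≤-trans (≤-trans (m≤m+n _ _) (double≤length-Φ v)) (≤-trans (m≤m+n _ o) (≤-reflexive (sym |w′|≡))))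
    }
    where
      w = Z ∷ w′
      q = suc q′
      E = suc p + length w′
      open InBlock (blockOf E) renaming (index to r; offset to o; j≡ to E≡; offset< to o<)
      q≤r : q ≤ r
      q≤r = start≤⇒≤ E (subst (_≤ E) sp≡ (m≤m+n (suc p) _)) (subst (_< start (suc r)) (sym E≡) (+-monoʳ-< (start r) o<))
      v = segment q (r ∸ q)
      ρ = segment (start r + 1) o
      image = Φ (v ++ [ U r ]) ++ [ Z ]
      wc-at′ : (w ++ [ c ]) at start q
      wc-at′ = subst ((w ++ [ c ]) at_) sp≡ wc-at
      w-at : w at start q
      w-at = proj₁ (at-++⁻ w [ c ] (start q) wc-at′)
      |w′|≡ : length w′ ≡ length (Φ v) + o
      |w′|≡ = +-cancelˡ-≡ (start q) _ _ (begin
          start q + length w′             ≡⟨ cong (_+ length w′) (sym sp≡) ⟩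
          E                               ≡⟨ E≡ ⟩
          start r + o                     ≡⟨ cong (_+ o) (sym (start+length-Φ-segment q≤r)) ⟩
          start q + length (Φ v) + o      ≡⟨ +-assoc (start q) _ o ⟩
          start q + (length (Φ v) + o)    ∎)
        where open ≡-Reasoning
      |wc|≤|image| : length (w ++ [ c ]) ≤ length image
      |wc|≤|image| = begin
          length (w ++ [ c ])                     ≡⟨ trans (length-++ w) (+-comm (suc (length w′)) 1) ⟩
          suc (suc (length w′))                   ≡⟨ cong (suc ∘ suc) |w′|≡ ⟩
          suc (suc (length (Φ v) + o))            ≡⟨ cong suc (sym (+-suc (length (Φ v)) o)) ⟩
          suc (length (Φ v) + suc o)              ≤⟨ s≤s (+-monoʳ-≤ (length (Φ v)) o<) ⟩
          suc (length (Φ v) + length (φ (U r)))   ≡⟨ cong suc (sym (length-Φ-∷ʳ v (U r))) ⟩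
          suc (length (Φ (v ++ [ U r ])))          ≡⟨ +-comm 1 _ ⟩
          length (Φ (v ++ [ U r ])) + 1           ≡⟨ sym (length-++ (Φ (v ++ [ U r ]))) ⟩
          length image                            ∎
        where open ≤-Reasoning hiding (start)

  classify : ∀ c → c ≡ Z ⊎ c ≡ L ⊎ (c ≢ Z × c ≢ L)
  classify c with c ≟ᶠ Z | c ≟ᶠ L
  ... | yes c≡Z | _ = inj₁ c≡Z
  ... | no _ | yes c≡L = inj₂ (inj₁ c≡L)
  ... | no c≢Z | no c≢L = inj₂ (inj₂ (c≢Z , c≢L))

  L-before : ∀ {c} → c ≡ Z ⊎ c ≡ L → Factor (L ∷ [ c ])
  L-before (inj₁ refl) = LZ-factor
  L-before (inj₂ refl) = LL-factor

  only-Z-before-middle : ∀ {x c} p → U p ≡ x → U (suc p) ≡ c → c ≢ Z → c ≢ L → x ≡ Z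
  only-Z-before-middle p up≡x usp≡c c≢Z c≢L =
    trans (sym up≡x) (pred-of-middle p (c≢Z ∘ trans (sym usp≡c)) (c≢L ∘ trans (sym usp≡c)))

  L-left-extension-[] : ∀ {x y c₁ c₂} → x ≢ y → Factor (x ∷ [ c₁ ]) → Factor (y ∷ [ c₂ ]) →
    Factor (L ∷ [ c₁ ]) ⊎ Factor (L ∷ [ c₂ ])
  L-left-extension-[] {c₁ = c₁} {c₂} x≢y (p₁ , up₁≡x , up₁′≡c₁ , _) (p₂ , up₂≡y , up₂′≡c₂ , _)
    with classify c₁ | classify c₂
  ... | inj₁ c₁≡Z | _ = inj₁ (L-before (inj₁ c₁≡Z))
  ... | inj₂ (inj₁ c₁≡L) | _ = inj₁ (L-before (inj₂ c₁≡L))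
  ... | inj₂ (inj₂ _) | inj₁ c₂≡Z = inj₂ (L-before (inj₁ c₂≡Z))
  ... | inj₂ (inj₂ _) | inj₂ (inj₁ c₂≡L) = inj₂ (L-before (inj₂ c₂≡L))
  ... | inj₂ (inj₂ (c₁≢Z , c₁≢L)) | inj₂ (inj₂ (c₂≢Z , c₂≢L)) =
    ⊥-elim (x≢y (trans (only-Z-before-middle p₁ up₁≡x up₁′≡c₁ c₁≢Z c₁≢L)
                       (sym (only-Z-before-middle p₂ up₂≡y up₂′≡c₂ c₂≢Z c₂≢L))))

  -- The right context c is part of the claim so that the induction can be run on the preimage x′ v c′.
  L-left-extension : ∀ n w → length w ≤ n → ∀ {x y c₁ c₂} → x ≢ y →
    Factor (x ∷ w ++ [ c₁ ]) → Factor (y ∷ w ++ [ c₂ ]) → Factor (L ∷ w ++ [ c₁ ]) ⊎ Factor (L ∷ w ++ [ c₂ ])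
  L-left-extension _ [] _ x≢y xc₁ yc₂ = L-left-extension-[] x≢y xc₁ yc₂
  L-left-extension (suc n) (fz ∷ w′) |w|≤ {x} {y} {c₁} {c₂} x≢y (p₁ , xwc₁-at) (p₂ , ywc₂-at) =
    Data.Sum.map (lift-left pre₁) (lift-left pre₂ ∘ subst (λ v → Factor (L ∷ v ++ [ P₂.c′ ])) v₁≡v₂) ih
    where
      pre₁ = leftPreimage x w′ c₁ p₁ xwc₁-at
      pre₂ = leftPreimage y w′ c₂ p₂ ywc₂-at
      module P₁ = LeftPreimage pre₁
      module P₂ = LeftPreimage pre₂
      v₁≡v₂ : P₁.v ≡ P₂.v
      v₁≡v₂ = Φ-Z-injectiveˡ P₁.v P₂.v P₁.ρ P₂.ρ P₁.ρ-free P₂.ρ-free (trans (sym P₁.w≡) P₂.w≡)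
      ih = L-left-extension n P₁.v (≤-pred (≤-trans P₁.shorter |w|≤))
             (λ x′≡y′ → x≢y (trans P₁.x≡second (trans (cong second x′≡y′) (sym P₂.x≡second))))
             P₁.preimage-factor (subst (λ v → Factor (P₂.x′ ∷ v ++ [ P₂.c′ ])) (sym v₁≡v₂) P₂.preimage-factor)
  L-left-extension (suc n) (fs k ∷ w′) _ x≢y (p₁ , up₁≡x , up₁′≡k , wc₁-at) (p₂ , up₂≡y , up₂′≡k , wc₂-at)
    with classify (fs k)
  ... | inj₂ (inj₂ (k≢Z , k≢L)) =
    ⊥-elim (x≢y (trans (only-Z-before-middle p₁ up₁≡x up₁′≡k k≢Z k≢L) (sym (only-Z-before-middle p₂ up₂≡y up₂′≡k k≢Z k≢L))))
  ... | inj₂ (inj₁ k≡L) with pred-of-L p₁ (trans up₁′≡k k≡L) | pred-of-L p₂ (trans up₂′≡k k≡L)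
  ...   | inj₂ up₁≡L | _ = inj₁ (p₁ , up₁≡L , up₁′≡k , wc₁-at)
  ...   | inj₁ _ | inj₂ up₂≡L = inj₂ (p₂ , up₂≡L , up₂′≡k , wc₂-at)
  ...   | inj₁ up₁≡Z | inj₁ up₂≡Z = ⊥-elim (x≢y (trans (sym up₁≡x) (trans up₁≡Z (trans (sym up₂≡Z) up₂≡y))))

  -- Right special factors have the right extension m

  -- c w x, with w ending with 0, as a factor of φ(c′ v x′).
  record RightPreimage (c : Letter m) (w : List (Letter m)) (x : Letter m) : Set where
    field
      c′ x′ : Letter m
      front τ v : List (Letter m)
      x≡second : x ≡ second x′
      preimage-factor : Factor (c′ ∷ v ++ [ x′ ])
      w≡ : w ≡ τ ++ Φ v ++ [ Z ]
      τ-free : ZeroFree τ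
      φc′≡ : φ c′ ≡ front ++ c ∷ τ
      shorter : length v < length w

  lift-right : ∀ {c w x} (pre : RightPreimage c w x) →
    let open RightPreimage pre in Factor (c′ ∷ v ++ [ L ]) → Factor (c ∷ w ++ [ L ])
  lift-right {c} {w} pre (t , cvL-at) =
    _ , proj₁ (at-++⁻ (c ∷ w ++ [ L ]) _ _ (proj₂ (at-++⁻ front _ (start t) (subst (_at start t) lifted≡ image-at))))
    where
      open RightPreimage pre
      image-at = Φ-Z-at (c′ ∷ v ++ [ L ]) t cvL-at
      lifted≡ : Φ (c′ ∷ v ++ [ L ]) ++ [ Z ] ≡ front ++ ((c ∷ w ++ [ L ]) ++ L ∷ Z ∷ [])
      lifted≡ = begin
          (φ c′ ++ Φ (v ++ [ L ])) ++ [ Z ]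
        ≡⟨ ++-assoc (φ c′) _ [ Z ] ⟩
          φ c′ ++ Φ (v ++ [ L ]) ++ [ Z ]
        ≡⟨ cong₂ (λ a b → a ++ b ++ [ Z ]) φc′≡ (trans (Φ-++ v [ L ]) (cong (Φ v ++_) (trans (++-identityʳ (φ L)) φ-L))) ⟩
          (front ++ c ∷ τ) ++ (Φ v ++ Z ∷ L ∷ L ∷ []) ++ [ Z ]
        ≡⟨ trans (++-assoc front (c ∷ τ) _) (cong (λ b → front ++ c ∷ τ ++ b) (++-assoc (Φ v) _ [ Z ])) ⟩
          front ++ c ∷ τ ++ Φ v ++ Z ∷ L ∷ L ∷ Z ∷ []
        ≡⟨ cong (λ b → front ++ c ∷ b) (sym tail≡) ⟩
          front ++ ((c ∷ w ++ [ L ]) ++ L ∷ Z ∷ [])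
        ∎
        where
          open ≡-Reasoning
          tail≡ : (w ++ [ L ]) ++ L ∷ Z ∷ [] ≡ τ ++ Φ v ++ Z ∷ L ∷ L ∷ Z ∷ []
          tail≡ = begin
              (w ++ [ L ]) ++ L ∷ Z ∷ []              ≡⟨ ++-assoc w [ L ] _ ⟩
              w ++ L ∷ L ∷ Z ∷ []                     ≡⟨ cong (_++ L ∷ L ∷ Z ∷ []) w≡ ⟩
              (τ ++ Φ v ++ [ Z ]) ++ L ∷ L ∷ Z ∷ []   ≡⟨ ++-assoc τ _ _ ⟩
              τ ++ (Φ v ++ [ Z ]) ++ L ∷ L ∷ Z ∷ []   ≡⟨ cong (τ ++_) (++-assoc (Φ v) [ Z ] _) ⟩
              τ ++ Φ v ++ Z ∷ L ∷ L ∷ Z ∷ []          ∎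

  block-split : ∀ q o → o < length (φ (U q)) →
    φ (U q) ≡ segment (start q) o ++ U (start q + o) ∷ segment (suc (start q + o)) (length (φ (U q)) ∸ suc o)
  block-split q o o< = begin
      φ (U q)                                             ≡⟨ sym (at⇒segment (φ (U q)) (start q) (φ-block-at q)) ⟩
      segment (start q) (length (φ (U q)))                ≡⟨ cong (segment (start q)) (sym (trans (+-suc o k) (m+[n∸m]≡n o<))) ⟩
      segment (start q) (o + suc k)                       ≡⟨ segment-++ (start q) o (suc k) ⟩
      segment (start q) o ++ segment (start q + o) (suc k) ≡⟨ cong (segment (start q) o ++_) (segment-suc (start q + o) k) ⟩
      segment (start q) o ++ U (start q + o) ∷ segment (suc (start q + o)) k ∎
    where
      open ≡-Reasoning
      k = length (φ (U q)) ∸ suc o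

  segment-Φ-Z-at : ∀ j k q n → j + k ≡ start q → (segment j k ++ Φ (segment q n) ++ [ Z ]) at j
  segment-Φ-Z-at j k q n j+k≡ = at-++⁺ (segment j k) _ j (segment-at j k)
    (subst ((Φ (segment q n) ++ [ Z ]) at_) (trans (sym j+k≡) (cong (j +_) (sym (length-segment j k))))
      (Φ-Z-at (segment q n) q (segment-at q n)))

  rightPreimage : ∀ c w″ x p → (c ∷ (w″ ++ [ Z ]) ++ [ x ]) at p → RightPreimage c (w″ ++ [ Z ]) x
  rightPreimage c w″ x p (up≡c , wx-at) = record
    { c′ = U q ; x′ = U r ; front = segment (start q) o ; τ = τ ; v = v
    ; x≡second = trans (sym (proj₁ (proj₂ Zx-at))) (trans (cong U (trans (cong suc F≡) (+-comm 1 (start r)))) (u-start+1 r))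
    ; preimage-factor = q , refl , segment-∷ʳ-at q<r
    ; w≡ = at-unique w _ (suc p) (proj₁ (at-++⁻ w [ x ] (suc p) wx-at)) (segment-Φ-Z-at (suc p) k (suc q) (r ∸ suc q) sp+k≡) |w|≡
    ; τ-free = subst (λ i → ZeroFree (segment i k)) (trans (+-suc (start q) o) (cong suc (sym p≡)))
                 (segment-inside-block-ZeroFree q (suc o) k (s≤s z≤n) (≤-reflexive (m+[n∸m]≡n o<)))
    ; φc′≡ = trans (subst (λ i → φ (U q) ≡ segment (start q) o ++ U i ∷ segment (suc i) k) (sym p≡) (block-split q o o<))
                   (cong (λ a → segment (start q) o ++ a ∷ τ) up≡c)
    ; shorter = ≤-trans (s≤s (≤-trans (≤-trans (m≤m+n _ _) (double≤length-Φ v)) (≤-trans (m≤n+m _ k) (≤-reflexive (sym |w″|≡)))))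
                        (≤-reflexive (trans (+-comm 1 _) (sym (length-++ w″))))
    }
    where
      open InBlock (blockOf p) renaming (index to q; offset to o; j≡ to p≡; offset< to o<)
      w = w″ ++ [ Z ]
      k = length (φ (U q)) ∸ suc o
      F = suc p + length w″
      Zx-at : (Z ∷ [ x ]) at F
      Zx-at = proj₂ (at-++⁻ w″ (Z ∷ [ x ]) (suc p) (subst (_at suc p) (++-assoc w″ [ Z ] [ x ]) wx-at))
      r = proj₁ (u≡Z⇒start F (proj₁ Zx-at))
      F≡ : F ≡ start r
      F≡ = proj₂ (u≡Z⇒start F (proj₁ Zx-at))
      q<r : q < r
      q<r = start-cancel-< (≤-trans (s≤s (≤-trans (m≤m+n (start q) o) (≤-reflexive (sym p≡))))
                                    (≤-trans (m≤m+n (suc p) (length w″)) (≤-reflexive F≡)))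
      v = segment (suc q) (r ∸ suc q)
      τ = segment (suc p) k
      sp+k≡ : suc p + k ≡ start (suc q)
      sp+k≡ = trans (cong (λ i → suc i + k) p≡) (trans (cong (_+ k) (sym (+-suc (start q) o)))
                (trans (+-assoc (start q) (suc o) k) (cong (start q +_) (m+[n∸m]≡n o<))))
      |w″|≡ : length w″ ≡ k + length (Φ v)
      |w″|≡ = +-cancelˡ-≡ (suc p) _ _ (begin
          suc p + length w″           ≡⟨ F≡ ⟩
          start r                     ≡⟨ sym (start+length-Φ-segment q<r) ⟩
          start (suc q) + length (Φ v) ≡⟨ cong (_+ length (Φ v)) (sym sp+k≡) ⟩
          suc p + k + length (Φ v)    ≡⟨ +-assoc (suc p) k _ ⟩
          suc p + (k + length (Φ v))  ∎)
        where open ≡-Reasoning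
      |w|≡ : length w ≡ length (τ ++ Φ v ++ [ Z ])
      |w|≡ = begin
          length (w″ ++ [ Z ])            ≡⟨ trans (length-++ w″) (cong (_+ 1) |w″|≡) ⟩
          k + length (Φ v) + 1            ≡⟨ +-assoc k _ 1 ⟩
          k + (length (Φ v) + 1)          ≡⟨ cong₂ _+_ (sym (length-segment (suc p) k)) (sym (length-++ (Φ v))) ⟩
          length τ + length (Φ v ++ [ Z ]) ≡⟨ sym (length-++ τ) ⟩
          length (τ ++ Φ v ++ [ Z ])      ∎
        where open ≡-Reasoning

  L-after : ∀ {c} → c ≡ Z ⊎ c ≡ L → Factor (c ∷ [ L ])
  L-after (inj₁ refl) = ZL-factor
  L-after (inj₂ refl) = LL-factor

  only-Z-after-middle : ∀ {c x} p → U p ≡ c → U (suc p) ≡ x → c ≢ Z → c ≢ L → x ≡ Z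
  only-Z-after-middle p up≡c usp≡x c≢Z c≢L =
    trans (sym usp≡x) (succ-of-middle p (c≢Z ∘ trans (sym up≡c)) (c≢L ∘ trans (sym up≡c)))

  L-right-extension-[] : ∀ {c₁ c₂ x y} → x ≢ y → Factor (c₁ ∷ [ x ]) → Factor (c₂ ∷ [ y ]) →
    Factor (c₁ ∷ [ L ]) ⊎ Factor (c₂ ∷ [ L ])
  L-right-extension-[] {c₁} {c₂} x≢y (p₁ , up₁≡c₁ , up₁′≡x , _) (p₂ , up₂≡c₂ , up₂′≡y , _)
    with classify c₁ | classify c₂
  ... | inj₁ c₁≡Z | _ = inj₁ (L-after (inj₁ c₁≡Z))
  ... | inj₂ (inj₁ c₁≡L) | _ = inj₁ (L-after (inj₂ c₁≡L))
  ... | inj₂ (inj₂ _) | inj₁ c₂≡Z = inj₂ (L-after (inj₁ c₂≡Z))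
  ... | inj₂ (inj₂ _) | inj₂ (inj₁ c₂≡L) = inj₂ (L-after (inj₂ c₂≡L))
  ... | inj₂ (inj₂ (c₁≢Z , c₁≢L)) | inj₂ (inj₂ (c₂≢Z , c₂≢L)) =
    ⊥-elim (x≢y (trans (only-Z-after-middle p₁ up₁≡c₁ up₁′≡x c₁≢Z c₁≢L)
                       (sym (only-Z-after-middle p₂ up₂≡c₂ up₂′≡y c₂≢Z c₂≢L))))

  last-two-at : ∀ c w″ k x p → (c ∷ (w″ ++ [ k ]) ++ [ x ]) at p →
    U (suc p + length w″) ≡ k × U (suc (suc p + length w″)) ≡ x
  last-two-at c w″ k x p (_ , wx-at)
    with proj₂ (at-++⁻ w″ (k ∷ [ x ]) (suc p) (subst (_at suc p) (++-assoc w″ [ k ] [ x ]) wx-at))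
  ... | uk , ux , _ = uk , ux

  L-right-extension : ∀ n w → length w ≤ n → ∀ {c₁ c₂ x y} → x ≢ y →
    Factor (c₁ ∷ w ++ [ x ]) → Factor (c₂ ∷ w ++ [ y ]) → Factor (c₁ ∷ w ++ [ L ]) ⊎ Factor (c₂ ∷ w ++ [ L ])
  L-right-extension zero [] _ x≢y c₁x c₂y = L-right-extension-[] x≢y c₁x c₂y
  L-right-extension (suc n) w |w|≤ {c₁} {c₂} {x} {y} x≢y (p₁ , cwx-at) (p₂ , cwy-at) with initLast w
  ... | [] = L-right-extension-[] x≢y (p₁ , cwx-at) (p₂ , cwy-at)
  ... | w″ ∷ʳ′ fz =
    Data.Sum.map (lift-right pre₁) (lift-right pre₂ ∘ subst (λ v → Factor (P₂.c′ ∷ v ++ [ L ])) v₁≡v₂) ih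
    where
      pre₁ = rightPreimage c₁ w″ x p₁ cwx-at
      pre₂ = rightPreimage c₂ w″ y p₂ cwy-at
      module P₁ = RightPreimage pre₁
      module P₂ = RightPreimage pre₂
      v₁≡v₂ : P₁.v ≡ P₂.v
      v₁≡v₂ = Φ-Z-injectiveʳ P₁.τ P₂.τ P₁.v P₂.v P₁.τ-free P₂.τ-free (trans (sym P₁.w≡) P₂.w≡)
      ih = L-right-extension n P₁.v (≤-pred (≤-trans P₁.shorter |w|≤))
             (λ x′≡y′ → x≢y (trans P₁.x≡second (trans (cong second x′≡y′) (sym P₂.x≡second))))
             P₁.preimage-factor (subst (λ v → Factor (P₂.c′ ∷ v ++ [ P₂.x′ ])) (sym v₁≡v₂) P₂.preimage-factor)
  ... | w″ ∷ʳ′ fs k with classify (fs k) | last-two-at c₁ w″ (fs k) x p₁ cwx-at | last-two-at c₂ w″ (fs k) y p₂ cwy-at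
  ...   | inj₂ (inj₂ (k≢Z , k≢L)) | uk₁ , ux | uk₂ , uy =
    ⊥-elim (x≢y (trans (only-Z-after-middle (suc p₁ + length w″) uk₁ ux k≢Z k≢L)
                       (sym (only-Z-after-middle (suc p₂ + length w″) uk₂ uy k≢Z k≢L))))
  ...   | inj₂ (inj₁ k≡L) | uk₁ , ux | uk₂ , uy
    with succ-of-L (suc p₁ + length w″) (trans uk₁ k≡L) | succ-of-L (suc p₂ + length w″) (trans uk₂ k≡L)
  ...     | inj₂ ux≡L | _ = inj₁ (p₁ , subst (λ a → (c₁ ∷ (w″ ++ [ fs k ]) ++ [ a ]) at p₁) (trans (sym ux) ux≡L) cwx-at)
  ...     | inj₁ _ | inj₂ uy≡L = inj₂ (p₂ , subst (λ a → (c₂ ∷ (w″ ++ [ fs k ]) ++ [ a ]) at p₂) (trans (sym uy) uy≡L) cwy-at)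
  ...     | inj₁ ux≡Z | inj₁ uy≡Z = ⊥-elim (x≢y (trans (sym ux) (trans ux≡Z (trans (sym uy≡Z) uy))))

  -- Recurrence

  Φ-prefix : ∀ n → Φ (segment 0 n) ≡ segment 0 (start n)
  Φ-prefix n = at-unique _ _ 0 (Φ-at (segment 0 n) 0 (segment-at 0 n)) (segment-at 0 (start n))
    (trans (start+length-Φ (segment 0 n) 0 (segment-at 0 n))
           (trans (cong start (length-segment 0 n)) (sym (length-segment 0 (start n)))))

  -- The image of a recurrence of u[0,n) is a recurrence of the longer prefix u[0,start n).
  prefix-recurs : ∀ n → Σ ℕ λ i → 0 < i × segment 0 n at i
  prefix-recurs zero = 1 , s≤s z≤n , tt
  prefix-recurs (suc zero) = start 1 , start<start-suc 0 , trans (u-start 1) (sym (u-start 0)) , tt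
  prefix-recurs (suc (suc n)) with prefix-recurs (suc n)
  ... | i , 0<i , prefix-at =
    start i , ≤-trans 0<i (≤-trans (m≤m+n i i) (double≤start i)) ,
    at-prefix (segment 0 (suc (suc n))) (segment 0 (start (suc n))) 0 (start i)
      (segment-at 0 _) (segment-at 0 _) |prefix|≤ (subst (_at start i) (Φ-prefix (suc n)) (Φ-at _ i prefix-at))
    where
      |prefix|≤ : length (segment 0 (suc (suc n))) ≤ length (segment 0 (start (suc n)))
      |prefix|≤ = subst₂ _≤_ (sym (length-segment 0 _)) (sym (length-segment 0 _))
                    (≤-trans (s≤s (m≤n+m (suc n) n)) (double≤start (suc n)))

  factor-at-positive : ∀ w → Factor w → Σ ℕ λ i → 0 < i × w at i
  factor-at-positive w (suc p , w-at) = suc p , s≤s z≤n , w-at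
  factor-at-positive w (zero , w-at) with prefix-recurs (length w)
  ... | i , 0<i , prefix-at = i , 0<i , subst (_at i) (at⇒segment w 0 w-at) prefix-at

  Consecutive : List (Letter m) → ℕ → ℕ → Set
  Consecutive w i j = i < j × w at i × w at j × (∀ k → i < k → k < j → ¬ w at k)

  -- A pair of consecutive occurrences at 0 and j is copied by a recurrence of u[0, j + |w|).
  consecutive-at-positive : ∀ w j → Consecutive w 0 j →
    Σ ℕ λ i → 0 < i × Consecutive w i (i + j) × segment i j ≡ segment 0 j
  consecutive-at-positive w j (0<j , w-at-0 , w-at-j , none) with prefix-recurs (j + length w)
  ... | i , 0<i , prefix-at =
    i , 0<i ,
    (m<m+n i 0<j , subst (w at_) (+-identityʳ i) (copy w 0 (m≤n+m _ j) w-at-0) , copy w j ≤-refl w-at-j , none′) ,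
    at-unique _ _ i (segment-at i j)
      (subst (segment 0 j at_) (+-identityʳ i)
        (copy (segment 0 j) 0 (subst (_≤ N) (sym (length-segment 0 j)) (m≤m+n j _)) (segment-at 0 j)))
      (trans (length-segment i j) (sym (length-segment 0 j)))
    where
      N = j + length w
      prefix-at-0 = segment-at 0 N
      copy : ∀ xs k → k + length xs ≤ N → xs at k → xs at (i + k)
      copy xs k bound xs-at =
        at-infix xs (segment 0 N) 0 k i xs-at prefix-at-0 (subst (_ ≤_) (sym (length-segment 0 N)) bound) prefix-at
      none′ : ∀ k → i < k → k < i + j → ¬ w at k
      none′ k i<k k<i+j w-at-k = none (k ∸ i) 0<k-i k-i<j
        (at-infix w (segment 0 N) i (k ∸ i) 0 (subst (w at_) (sym i+[k-i]≡k) w-at-k) prefix-at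
          (subst (_ ≤_) (sym (length-segment 0 N)) (+-monoˡ-≤ (length w) (<⇒≤ k-i<j))) prefix-at-0)
        where
          i+[k-i]≡k : i + (k ∸ i) ≡ k
          i+[k-i]≡k = m+[n∸m]≡n (<⇒≤ i<k)
          0<k-i : 0 < k ∸ i
          0<k-i = +-cancelˡ-< i 0 _ (subst₂ _<_ (sym (+-identityʳ i)) (sym i+[k-i]≡k) i<k)
          k-i<j : k ∸ i < j
          k-i<j = +-cancelˡ-< i _ j (subst (_< i + j) (sym i+[k-i]≡k) k<i+j)

  -- Occurrences of the offspring

  AdmissiblePrefix AdmissibleSuffix : List (Letter m) → List (Letter m) → Set
  AdmissiblePrefix w pre = pre ≡ [] ⊎ (pre ≡ [ L ] × (∀ z → Factor (z ∷ w) → second z ≡ L))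
  AdmissibleSuffix w post = post ≡ [] ⊎ (post ≡ [ L ] × (∀ z → Factor (w ++ [ z ]) → second z ≡ L))

  framedImage : List (Letter m) → List (Letter m) → List (Letter m) → List (Letter m)
  framedImage pre w post = pre ++ Φ w ++ Z ∷ post

  Φ-Z-post-at : ∀ {w post} i → AdmissibleSuffix w post → w at i → (Φ w ++ Z ∷ post) at start i
  Φ-Z-post-at {w} {post} i post-ok w-at = at-++⁺ (Φ w) (Z ∷ post) (start i) (Φ-at w i w-at)
    (subst ((Z ∷ post) at_) (sym (start+length-Φ w i w-at)) (u-start n , post-at post-ok))
    where
      n = i + length w
      post-at : AdmissibleSuffix w post → post at suc (start n)
      post-at (inj₁ refl) = tt
      post-at (inj₂ (refl , second≡L)) =
        trans (cong U (+-comm 1 (start n))) (trans (u-start+1 n) (second≡L (U n) (i , at-++⁺ w [ U n ] i w-at (refl , tt)))) , tt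

  framedImage-at : ∀ {w pre post} i → AdmissiblePrefix w pre → AdmissibleSuffix w post → 0 < i → w at i →
    Σ ℕ λ k → k + length pre ≡ start i × framedImage pre w post at k
  framedImage-at (suc i) (inj₁ refl) post-ok _ w-at = start (suc i) , +-identityʳ _ , Φ-Z-post-at (suc i) post-ok w-at
  framedImage-at {w} {post = post} (suc i) (inj₂ (refl , second≡L)) post-ok _ w-at =
    k , k+1≡ , uk≡L , subst ((Φ w ++ Z ∷ post) at_) (sym sk≡) (Φ-Z-post-at (suc i) post-ok w-at)
    where
      k = start (suc i) ∸ 1
      k+1≡ : k + 1 ≡ start (suc i)
      k+1≡ = m∸n+n≡m (start-mono-< {0} {suc i} (s≤s z≤n))
      sk≡ : suc k ≡ start (suc i)
      sk≡ = trans (+-comm 1 k) k+1≡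
      uk≡L : U k ≡ L
      uk≡L = trans (u-before-start k i sk≡) (second≡L (U i) (i , refl , w-at))

  Φ-Z-at⇒u≡Z : ∀ v i → v ≢ [] → (Φ v ++ [ Z ]) at i → U i ≡ Z
  Φ-Z-at⇒u≡Z [] i v≢[] _ = ⊥-elim (v≢[] refl)
  Φ-Z-at⇒u≡Z (c ∷ v) i _ Φv-Z-at with φ-shape c
  ... | t , φc≡ , _ = proj₁ (subst (_at i) (trans (++-assoc (φ c) (Φ v) [ Z ]) (cong (_++ Φ v ++ [ Z ]) φc≡)) Φv-Z-at)

  framedImage-at⁻¹ : ∀ {w} pre post k → w ≢ [] → framedImage pre w post at k → Σ ℕ λ l → k + length pre ≡ start l × w at l
  framedImage-at⁻¹ {w} pre post k w≢[] image-at = l , k+e≡ , Φ-Z-at⁻¹ w l (subst ((Φ w ++ [ Z ]) at_) k+e≡ Φw-Z-at)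
    where
      e = length pre
      Φw-Z-at : (Φ w ++ [ Z ]) at (k + e)
      Φw-Z-at with at-++⁻ (Φ w) (Z ∷ post) (k + e) (proj₂ (at-++⁻ pre (Φ w ++ Z ∷ post) k image-at))
      ... | Φw-at , (uZ , _) = at-++⁺ (Φ w) [ Z ] (k + e) Φw-at (uZ , tt)
      l = proj₁ (u≡Z⇒start (k + e) (Φ-Z-at⇒u≡Z w (k + e) w≢[] Φw-Z-at))
      k+e≡ = proj₂ (u≡Z⇒start (k + e) (Φ-Z-at⇒u≡Z w (k + e) w≢[] Φw-Z-at))

  framedImage-consecutive : ∀ {w pre post} i j → w ≢ [] → AdmissiblePrefix w pre → AdmissibleSuffix w post →
    0 < i → Consecutive w i j →
    Σ ℕ λ k → Σ ℕ λ k′ → Consecutive (framedImage pre w post) k k′ × pre ++ Φ (segment i (j ∸ i)) ≡ segment k (k′ ∸ k) ++ pre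
  framedImage-consecutive {w} {pre} {post} i j w≢[] pre-ok post-ok 0<i (i<j , w-at-i , w-at-j , none)
    with framedImage-at i pre-ok post-ok 0<i w-at-i | framedImage-at j pre-ok post-ok (<-trans 0<i i<j) w-at-j
  ... | k , k+e≡ , image-at-k | k′ , k′+e≡ , image-at-k′ =
    k , k′ , (k<k′ , image-at-k , image-at-k′ , none′) ,
    at-unique _ _ k (at-++⁺ pre (Φ r) k pre-at-k (subst (Φ r at_) (sym k+e≡) (Φ-at r i r-at)))
                    (at-++⁺ y pre k (segment-at k _) (subst (pre at_) (sym k+|y|≡k′) pre-at-k′)) |pre++Φr|≡
    where
      e = length pre
      r = segment i (j ∸ i)
      r-at = segment-at i (j ∸ i)
      y = segment k (k′ ∸ k)
      k<k′ : k < k′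
      k<k′ = +-cancelʳ-< e k k′ (subst₂ _<_ (sym k+e≡) (sym k′+e≡) (start-mono-< i<j))
      k+|y|≡k′ : k + length y ≡ k′
      k+|y|≡k′ = trans (cong (k +_) (length-segment k _)) (m+[n∸m]≡n (<⇒≤ k<k′))
      pre-at-k = proj₁ (at-++⁻ pre _ k image-at-k)
      pre-at-k′ = proj₁ (at-++⁻ pre _ k′ image-at-k′)
      none′ : ∀ k″ → k < k″ → k″ < k′ → ¬ framedImage pre w post at k″
      none′ k″ k<k″ k″<k′ image-at-k″ with framedImage-at⁻¹ pre post k″ w≢[] image-at-k″
      ... | l , k″+e≡ , w-at-l =
        none l (start-cancel-< (subst₂ _<_ k+e≡ k″+e≡ (+-monoˡ-< e k<k″)))
               (start-cancel-< (subst₂ _<_ k″+e≡ k′+e≡ (+-monoˡ-< e k″<k′))) w-at-l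
      |pre++Φr|≡ : length (pre ++ Φ r) ≡ length (y ++ pre)
      |pre++Φr|≡ = +-cancelˡ-≡ k _ _ (begin
          k + length (pre ++ Φ r)   ≡⟨ trans (cong (k +_) (length-++ pre)) (sym (+-assoc k e _)) ⟩
          k + e + length (Φ r)      ≡⟨ cong (_+ length (Φ r)) k+e≡ ⟩
          start i + length (Φ r)    ≡⟨ start+length-Φ r i r-at ⟩
          start (i + length r)      ≡⟨ cong start (trans (cong (i +_) (length-segment i _)) (m+[n∸m]≡n (<⇒≤ i<j))) ⟩
          start j                   ≡⟨ sym k′+e≡ ⟩
          k′ + e                    ≡⟨ cong (_+ e) (sym k+|y|≡k′) ⟩
          k + length y + e          ≡⟨ trans (+-assoc k _ e) (cong (k +_) (sym (length-++ y))) ⟩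
          k + length (y ++ pre)     ∎)
        where open ≡-Reasoning

  -- Extensions, return words and the offspring

  IsFactor⇒Factor : ∀ {w} → IsFactor {m} w → Factor w
  IsFactor⇒Factor {w} (i , occ) = i , segment⇒at w i occ

  Factor⇒IsFactor : ∀ {w} → Factor w → IsFactor {m} w
  Factor⇒IsFactor {w} (i , w-at) = i , at⇒segment w i w-at

  at-extendʳ : ∀ w p → w at p → (w ++ [ U (p + length w) ]) at p
  at-extendʳ w p w-at = at-++⁺ w _ p w-at (refl , tt)

  ExactlyTwoLeft⇒LeftExt-L : ∀ {w} → ExactlyTwoLeft {m} w → LeftExt {m} w L
  ExactlyTwoLeft⇒LeftExt-L {w} (c₁ , c₂ , c₁≢c₂ , ext₁ , ext₂ , _)
    with IsFactor⇒Factor ext₁ | IsFactor⇒Factor ext₂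
  ... | p₁ , c₁w-at | p₂ , c₂w-at =
    Factor⇒IsFactor (drop-last (L-left-extension (length w) w ≤-refl c₁≢c₂
      (p₁ , at-extendʳ (c₁ ∷ w) p₁ c₁w-at) (p₂ , at-extendʳ (c₂ ∷ w) p₂ c₂w-at)))
    where
      drop-last : ∀ {x y} → Factor (L ∷ w ++ [ x ]) ⊎ Factor (L ∷ w ++ [ y ]) → Factor (L ∷ w)
      drop-last (inj₁ (t , Lwx-at)) = t , proj₁ (at-++⁻ (L ∷ w) _ t Lwx-at)
      drop-last (inj₂ (t , Lwy-at)) = t , proj₁ (at-++⁻ (L ∷ w) _ t Lwy-at)

  ExactlyTwoRight⇒RightExt-L : ∀ {w} → ExactlyTwoRight {m} w → RightExt {m} w L
  ExactlyTwoRight⇒RightExt-L {w} (c₁ , c₂ , c₁≢c₂ , ext₁ , ext₂ , _)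
    with factor-at-positive _ (IsFactor⇒Factor ext₁) | factor-at-positive _ (IsFactor⇒Factor ext₂)
  ... | suc p₁ , _ , wc₁-at | suc p₂ , _ , wc₂-at =
    Factor⇒IsFactor (drop-first (L-right-extension (length w) w ≤-refl c₁≢c₂ (p₁ , refl , wc₁-at) (p₂ , refl , wc₂-at)))
    where
      drop-first : ∀ {x y} → Factor (x ∷ w ++ [ L ]) ⊎ Factor (y ∷ w ++ [ L ]) → Factor (w ++ [ L ])
      drop-first (inj₁ (t , (_ , wL-at))) = suc t , wL-at
      drop-first (inj₂ (t , (_ , wL-at))) = suc t , wL-at

  -- The empty word has the three left extensions 0, 1 and m.
  ExactlyTwoLeft⇒≢[] : ∀ {w} → ExactlyTwoLeft {m} w → w ≢ []
  ExactlyTwoLeft⇒≢[] (_ , _ , _ , _ , _ , only) refl =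
    ∈-pair-three (λ Z≡1 → second≢Z Z (sym Z≡1)) Z≢L 1≢L
      (only Z (Factor⇒IsFactor (0 , u-start 0 , tt)))
      (only (second Z) (Factor⇒IsFactor (1 , trans (u-start+1 0) (cong second (u-start 0)) , tt)))
      (only L (Factor⇒IsFactor (proj₁ L-occurs , proj₂ L-occurs , tt)))
    where
      1≢L : second Z ≢ L
      1≢L 1≡L = <-irrefl (trans (sym (toℕ-second Z (≤-trans (s≤s z≤n) 2≤m))) (trans (cong toℕ 1≡L) toℕ-L)) 2≤m

  lastIf : ∀ {k} → Dec (k ≡ m) → List (Letter m)
  lastIf (yes _) = [ L ]
  lastIf (no _) = []

  second≡L : ∀ c → toℕ c < m → suc (toℕ c) ≡ m → second c ≡ L
  second≡L c c<m sc≡m = toℕ-injective (trans (toℕ-second c c<m) (trans sc≡m (sym toℕ-L)))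

  admissiblePrefix : ∀ a w → toℕ a < m → ExactlyTwoLeft {m} w → LeftExt {m} w a →
    (d : Dec (suc (toℕ a) ≡ m)) → AdmissiblePrefix w (lastIf d)
  admissiblePrefix _ _ _ _ _ (no _) = inj₁ refl
  admissiblePrefix a w a<m two@(_ , _ , _ , _ , _ , only) ext (yes sa≡m) = inj₂ (refl , λ z z-ext →
    second-of-ext (∈-pair-cover (<m⇒≢L a<m) (only a ext) (only L (ExactlyTwoLeft⇒LeftExt-L two)) (only z (Factor⇒IsFactor z-ext))))
    where
      second-of-ext : ∀ {z} → z ≡ a ⊎ z ≡ L → second z ≡ L
      second-of-ext (inj₁ refl) = second≡L a a<m sa≡m
      second-of-ext (inj₂ refl) = second-L

  admissibleSuffix : ∀ b w → toℕ b < m → ExactlyTwoRight {m} w → RightExt {m} w b →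
    (d : Dec (suc (toℕ b) ≡ m)) → AdmissibleSuffix w (lastIf d)
  admissibleSuffix _ _ _ _ _ (no _) = inj₁ refl
  admissibleSuffix b w b<m two@(_ , _ , _ , _ , _ , only) ext (yes sb≡m) = inj₂ (refl , λ z z-ext →
    second-of-ext (∈-pair-cover (<m⇒≢L b<m) (only b ext) (only L (ExactlyTwoRight⇒RightExt-L two)) (only z (Factor⇒IsFactor z-ext))))
    where
      second-of-ext : ∀ {z} → z ≡ b ⊎ z ≡ L → second z ≡ L
      second-of-ext (inj₁ refl) = second≡L b b<m sb≡m
      second-of-ext (inj₂ refl) = second-L

  offspring≡framedImage : ∀ a w b → offspring a w b ≡ framedImage (lastIf (suc (toℕ a) ≟ m)) w (lastIf (suc (toℕ b) ≟ m))
  offspring≡framedImage a w b with suc (toℕ a) ≟ m | suc (toℕ b) ≟ m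
  ... | yes _ | yes _ = refl
  ... | yes _ | no _ = refl
  ... | no _ | yes _ = refl
  ... | no _ | no _ = refl

  lcs-φ-L : ∀ a → toℕ a < m → lcs (φ a) (φ L) ≡ lastIf (suc (toℕ a) ≟ m)
  lcs-φ-L a a<m with φ-cases a
  ... | inj₂ (a≡L , _) = ⊥-elim (<m⇒≢L a<m a≡L)
  ... | inj₁ (a<m′ , φa≡) rewrite φa≡ | φ-L with next a a<m′ ≟ᶠ L | suc (toℕ a) ≟ m
  ...   | yes next≡L | yes _ with Z ≟ᶠ L
  ...     | yes Z≡L = ⊥-elim (Z≢L Z≡L)
  ...     | no _ = cong [_] next≡L
  lcs-φ-L a a<m | inj₁ (a<m′ , _) | yes next≡L | no sa≢m =
    ⊥-elim (sa≢m (trans (sym (toℕ-next a a<m′)) (trans (cong toℕ next≡L) toℕ-L)))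
  lcs-φ-L a a<m | inj₁ (a<m′ , _) | no next≢L | yes sa≡m =
    ⊥-elim (next≢L (toℕ-injective (trans (toℕ-next a a<m′) (trans sa≡m (sym toℕ-L)))))
  lcs-φ-L a a<m | inj₁ (a<m′ , _) | no _ | no _ = refl

  IsReturnWord⇒Consecutive : ∀ {w r} → IsReturnWord {m} w r → Σ ℕ λ i → Σ ℕ λ j → Consecutive w i j × r ≡ segment i (j ∸ i)
  IsReturnWord⇒Consecutive {w} (i , j , i<j , occ-i , occ-j , none , r≡) =
    i , j , (i<j , segment⇒at w i occ-i , segment⇒at w j occ-j , λ k i<k k<j w-at → none k i<k k<j (at⇒segment w k w-at)) , r≡

  consecutive-positive : ∀ {w} i j → Consecutive w i j →
    Σ ℕ λ i′ → Σ ℕ λ j′ → 0 < i′ × Consecutive w i′ j′ × segment i′ (j′ ∸ i′) ≡ segment i (j ∸ i)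
  consecutive-positive (suc i) j cons = suc i , j , s≤s z≤n , cons , refl
  consecutive-positive {w} zero j cons with consecutive-at-positive w j cons
  ... | i , 0<i , cons′ , segment≡ = i , i + j , 0<i , cons′ , trans (cong (segment i) (m+n∸m≡n i j)) segment≡

  Consecutive⇒IsReturnWord : ∀ {w} k k′ → Consecutive w k k′ → IsReturnWord {m} w (segment k (k′ ∸ k))
  Consecutive⇒IsReturnWord {w} k k′ (k<k′ , w-at-k , w-at-k′ , none) =
    k , k′ , k<k′ , at⇒segment w k w-at-k , at⇒segment w k′ w-at-k′ ,
    (λ k″ k<k″ k″<k′ occ → none k″ k<k″ k″<k′ (segment⇒at w k″ occ)) , refl

  offspring-return-word : ∀ a w b → InT a w b → ExactlyTwoLeft {m} w → ExactlyTwoRight {m} w → ∀ r → IsReturnWord {m} w r →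
    Σ (List (Letter m)) λ y → (lcs (φ a) (φ L) ++ Φ r ≡ y ++ lcs (φ a) (φ L)) × IsReturnWord (offspring a w b) y
  offspring-return-word a w b (_ , a<m , b<m , a-ext , b-ext) two-left two-right r rw
    with IsReturnWord⇒Consecutive rw
  ... | i₀ , j₀ , cons₀ , r≡ with consecutive-positive i₀ j₀ cons₀
  ... | i , j , 0<i , cons , segment≡
    with framedImage-consecutive i j (ExactlyTwoLeft⇒≢[] two-left)
           (admissiblePrefix a w a<m two-left a-ext (suc (toℕ a) ≟ m))
           (admissibleSuffix b w b<m two-right b-ext (suc (toℕ b) ≟ m)) 0<i cons
  ...   | k , k′ , cons′ , framed≡ =
    segment k (k′ ∸ k) ,
    subst (λ s → s ++ Φ r ≡ segment k (k′ ∸ k) ++ s) (sym (lcs-φ-L a a<m))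
      (subst (λ r → _ ++ Φ r ≡ _) (sym (trans r≡ (sym segment≡))) framed≡) ,
    subst (λ v → IsReturnWord v _) (sym (offspring≡framedImage a w b)) (Consecutive⇒IsReturnWord k k′ cons′)

lemma16 : (m : ℕ) → 2 ≤ m →
    (a b : Letter m) (w : List (Letter m)) →
    InT a w b → ExactlyTwoLeft w → ExactlyTwoRight w →
    ((r : List (Letter m)) → IsReturnWord w r →
      Σ (List (Letter m)) λ y →
        (lcs (φ a) (φ (lastL {m})) ++ φ* r ≡ y ++ lcs (φ a) (φ (lastL {m})))
        × IsReturnWord (offspring a w b) y)
    ×
    ((r : List (Letter m)) → IsReturnWord w r →
      Σ (List (Letter m)) λ r' →
        IsReturnWord (offspring a w b) r' × ((i : Letter m) → Parikh r' i ≡ (M· Parikh r) i))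
lemma16 m 2≤m a b w inT two-left two-right =
    offspring-return-word a w b inT two-left two-right ,
    λ r r-return → let (y , conjugate , y-return) = offspring-return-word a w b inT two-left two-right r r-return
                   in y , y-return , conjugate-Parikh _ r y conjugate
  where open FixedPoint m 2≤m using (offspring-return-word)
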